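{- Let $\Gamma$ be a finite set of PDL$^\Box$-formulas. The canonical model $M^\mathsf{c}(\Gamma)=\langle S(\Gamma),v^\mathsf{c}_\mathsf{f},v^\mathsf{c}_\mathsf{p},R^\mathsf{c}_\Box\rangle$ is a PDL$^\Box$-model.
   Context: PDL$^\Box$-formulas over countably infinite $\mathsf{At}_\mathsf{f}$, $\mathsf{At}_\mathsf{p}$: $\gamma ::= a\mid\bot\mid\neg\gamma\mid\gamma\lor\gamma\mid\langle\pi\rangle\gamma\mid\Box\gamma$, $\pi::=\mathsf{p}\mid\pi;\pi\mid\pi\cup\pi\mid\pi^*\mid ?\gamma$; $[\pi]\gamma:=\neg\langle\pi\rangle\neg\gamma$, $\Diamond\gamma:=\neg\Box\neg\gamma$. $\vdash$ is derivability in PDL$^\Box$: axioms propositional tautologies; $[\pi](\gamma_1\to\gamma_2)\to([\pi]\gamma_1\to[\pi]\gamma_2)$; $[\pi](\gamma_1\land\gamma_2)\leftrightarrow([\pi]\gamma_1\land[\pi]\gamma_2)$; $[\pi_1\cup\pi_2]\gamma\leftrightarrow([\pi_1]\gamma\land[\pi_2]\gamma)$; $[?\alpha]\beta\leftrightarrow(\alpha\to\beta)$; $[\pi_1;\pi_2]\gamma\leftrightarrow[\pi_1][\pi_2]\gamma$; $(\gamma\land[\pi][\pi^*]\gamma)\leftrightarrow[\pi^*]\gamma$; $(\gamma\land[\pi^*](\gamma\to[\pi]\gamma))\to[\pi^*]\gamma$; $\Box(\gamma_1\to\gamma_2)\to(\Box\gamma_1\to\Box\gamma_2)$; $\Box\gamma\to\gamma$;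 $\Diamond\gamma\to\Box\Diamond\gamma$; $\langle\pi\rangle\gamma\to\Diamond\gamma$; rules modus ponens, $\gamma\Rightarrow[\pi]\gamma$, $\gamma\Rightarrow\Box\gamma$; $\varphi\not\vdash\bot$ means $\not\vdash\neg\varphi$. Fischer–Ladner closure $\mathsf{FL}(\Gamma)$: smallest set containing $\Gamma$, closed under subformulas, with $\langle ?\gamma_1\rangle\gamma_2\in\mathsf{FL}\Rightarrow\gamma_1\in\mathsf{FL}$; $\langle\pi_1;\pi_2\rangle\gamma\in\mathsf{FL}\Rightarrow\langle\pi_1\rangle\langle\pi_2\rangle\gamma\in\mathsf{FL}$; $\langle\pi_1\cup\pi_2\rangle\gamma\in\mathsf{FL}\Rightarrow\langle\pi_1\rangle\gamma,\langle\pi_2\rangle\gamma\in\mathsf{FL}$; $\langle\pi^*\rangle\gamma\in\mathsf{FL}\Rightarrow\langle\pi\rangle\gamma,\langle\pi\rangle\langle\pi^*\rangle\gamma\in\mathsf{FL}$. $\mathsf{FL}^\pm(\Gamma)=\mathsf{FL}(\Gamma)\cup\{\neg\gamma:\gamma\in\mathsf{FL}(\Gamma)\}$; $S(\Gamma)$ is the set of maximal consistent subsets of $\mathsf{FL}^\pm(\Gamma)$; each $W\in S(\Gamma)$ is identified with the formula $\bigwedge W$. Canonical model: $v^\mathsf{c}_\mathsf{f}(a)=\{W\in S(\Gamma):a\in W\}$; $\langle W_1,W_2\rangle\in v^\mathsf{c}_\mathsf{p}(\mathsf{p})$ iff $W_1\land\langle\mathsf{p}\rangle W_2\not\vdash\bot$;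 $\langle W_1,W_2\rangle\in R^\mathsf{c}_\Box$ iff $W_1\land\Diamond W_2\not\vdash\bot$. A PDL$^\Box$-model is a tuple $\langle S,v_\mathsf{f},v_\mathsf{p},R_\Box\rangle$ with $S\ne\emptyset$, $v_\mathsf{f}:\mathsf{At}_\mathsf{f}\to2^S$, $v_\mathsf{p}:\mathsf{At}_\mathsf{p}\to2^{S\times S}$, $R_\Box$ an equivalence relation on $S$, and $v_\mathsf{p}(\mathsf{p})\subseteq R_\Box$ for all $\mathsf{p}\in\mathsf{At}_\mathsf{p}$. -}

module Defs where

open import Data.Nat using (ℕ)
open import Data.Bool using (Bool; true; false; not; _∨_)
open import Data.List using (List; []; _∷_)
open import Data.List.Membership.Propositional using (_∈_)
open import Data.List.Relation.Unary.All using (All)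
open import Data.Product using (Σ; _×_; _,_)
open import Data.Sum using (_⊎_)
open import Relation.Binary.PropositionalEquality using (_≡_)
open import Relation.Binary.Definitions using (Reflexive; Symmetric; Transitive)
open import Relation.Nullary using (¬_)

infixr 30 _∨'_
infixr 40 ¬'_
infixr 40 ⟨_⟩_
infixr 40 □_
infixr 40 [_]_
infixr 40 ◇_
infixr 25 _⨟_
infixr 24 _∪'_

mutual
  data Fm : Set where
    atm  : ℕ → Fm
    fal  : Fm
    ¬'_  : Fm → Fm
    _∨'_ : Fm → Fm → Fm
    ⟨_⟩_ : Prg → Fm → Fm
    □_   : Fm → Fm

  data Prg : Set where
    prg  : ℕ → Prg
    _⨟_  : Prg → Prg → Prg
    _∪'_ : Prg → Prg → Prg
    _*   : Prg → Prg
    ¿_   : Fm → Prg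

infixr 20 _⇒_
infixr 35 _∧'_
infix 15 _⇔_

_⇒_ : Fm → Fm → Fm
a ⇒ b = ¬' a ∨' b

_∧'_ : Fm → Fm → Fm
a ∧' b = ¬' (¬' a ∨' ¬' b)

_⇔_ : Fm → Fm → Fm
a ⇔ b = (a ⇒ b) ∧' (b ⇒ a)

⊤' : Fm
⊤' = ¬' fal

[_]_ : Prg → Fm → Fm
[ π ] γ = ¬' ⟨ π ⟩ ¬' γ

◇_ : Fm → Fm
◇ γ = ¬' □ ¬' γ

-- Propositional tautologies: true under every Boolean assignment to the
-- propositionally-atomic formulas (atoms, ⟨π⟩γ, □γ).

tval : (Fm → Bool) → Fm → Bool
tval v fal        = false
tval v (¬' a)     = not (tval v a)
tval v (a ∨' b)   = tval v a ∨ tval v b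
tval v (atm a)    = v (atm a)
tval v (⟨ π ⟩ a)  = v (⟨ π ⟩ a)
tval v (□ a)      = v (□ a)

Tautology : Fm → Set
Tautology φ = (v : Fm → Bool) → tval v φ ≡ true

infix 5 ⊢_

data ⊢_ : Fm → Set where
  taut   : ∀ {φ} → Tautology φ → ⊢ φ
  K[]    : ∀ {π γ₁ γ₂} → ⊢ [ π ] (γ₁ ⇒ γ₂) ⇒ ([ π ] γ₁ ⇒ [ π ] γ₂)
  ∧[]    : ∀ {π γ₁ γ₂} → ⊢ [ π ] (γ₁ ∧' γ₂) ⇔ ([ π ] γ₁ ∧' [ π ] γ₂)
  ∪ax    : ∀ {π₁ π₂ γ} → ⊢ [ π₁ ∪' π₂ ] γ ⇔ ([ π₁ ] γ ∧' [ π₂ ] γ)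
  ?ax    : ∀ {α β} → ⊢ [ ¿ α ] β ⇔ (α ⇒ β)
  ⨟ax    : ∀ {π₁ π₂ γ} → ⊢ [ π₁ ⨟ π₂ ] γ ⇔ [ π₁ ] [ π₂ ] γ
  *ax    : ∀ {π γ} → ⊢ (γ ∧' [ π ] [ π * ] γ) ⇔ [ π * ] γ
  ind    : ∀ {π γ} → ⊢ (γ ∧' [ π * ] (γ ⇒ [ π ] γ)) ⇒ [ π * ] γ
  K□     : ∀ {γ₁ γ₂} → ⊢ □ (γ₁ ⇒ γ₂) ⇒ (□ γ₁ ⇒ □ γ₂)
  T□     : ∀ {γ} → ⊢ □ γ ⇒ γ
  5□     : ∀ {γ} → ⊢ ◇ γ ⇒ □ ◇ γ
  ⟨⟩◇    : ∀ {π γ} → ⊢ ⟨ π ⟩ γ ⇒ ◇ γ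
  mp     : ∀ {γ₁ γ₂} → ⊢ γ₁ ⇒ γ₂ → ⊢ γ₁ → ⊢ γ₂
  nec[]  : ∀ {π γ} → ⊢ γ → ⊢ [ π ] γ
  nec□   : ∀ {γ} → ⊢ γ → ⊢ □ γ

Consistent : Fm → Set
Consistent φ = ¬ (⊢ ¬' φ)

data FL (Γ : List Fm) : Fm → Set where
  base  : ∀ {φ} → φ ∈ Γ → FL Γ φ
  sub¬  : ∀ {φ} → FL Γ (¬' φ) → FL Γ φ
  sub∨₁ : ∀ {φ ψ} → FL Γ (φ ∨' ψ) → FL Γ φ
  sub∨₂ : ∀ {φ ψ} → FL Γ (φ ∨' ψ) → FL Γ ψ
  sub⟨⟩ : ∀ {π φ} → FL Γ (⟨ π ⟩ φ) → FL Γ φ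
  sub□  : ∀ {φ} → FL Γ (□ φ) → FL Γ φ
  test  : ∀ {γ₁ γ₂} → FL Γ (⟨ ¿ γ₁ ⟩ γ₂) → FL Γ γ₁
  seq   : ∀ {π₁ π₂ γ} → FL Γ (⟨ π₁ ⨟ π₂ ⟩ γ) → FL Γ (⟨ π₁ ⟩ ⟨ π₂ ⟩ γ)
  cup₁  : ∀ {π₁ π₂ γ} → FL Γ (⟨ π₁ ∪' π₂ ⟩ γ) → FL Γ (⟨ π₁ ⟩ γ)
  cup₂  : ∀ {π₁ π₂ γ} → FL Γ (⟨ π₁ ∪' π₂ ⟩ γ) → FL Γ (⟨ π₂ ⟩ γ)
  star₁ : ∀ {π γ} → FL Γ (⟨ π * ⟩ γ) → FL Γ (⟨ π ⟩ γ)
  star₂ : ∀ {π γ} → FL Γ (⟨ π * ⟩ γ) → FL Γ (⟨ π ⟩ ⟨ π * ⟩ γ)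

FL± : List Fm → Fm → Set
FL± Γ φ = FL Γ φ ⊎ Σ Fm (λ ψ → FL Γ ψ × φ ≡ ¬' ψ)

-- Finite sets of formulas are given by lists enumerating their elements;
-- a set W is identified with the formula ⋀W.

⋀ : List Fm → Fm
⋀ []       = ⊤'
⋀ (x ∷ xs) = x ∧' ⋀ xs

_⊆_ : List Fm → List Fm → Set
W ⊆ V = ∀ {x} → x ∈ W → x ∈ V

record MCS (Γ : List Fm) (W : List Fm) : Set where
  field
    inFL±      : All (FL± Γ) W
    consistent : Consistent (⋀ W)
    maximal    : (V : List Fm) → All (FL± Γ) V → W ⊆ V →
                 Consistent (⋀ V) → V ⊆ W

S : List Fm → Set
S Γ = Σ (List Fm) (MCS Γ)

record IsPDL□Model (St : Set) (vf : ℕ → St → Set)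
                   (vp : ℕ → St → St → Set) (R□ : St → St → Set) : Set₁ where
  field
    nonempty : St
    R-refl   : Reflexive R□
    R-sym    : Symmetric R□
    R-trans  : Transitive R□
    vp⊆R□    : ∀ p {s t} → vp p s t → R□ s t

vᶜf : (Γ : List Fm) → ℕ → S Γ → Set
vᶜf Γ a (W , _) = atm a ∈ W

vᶜp : (Γ : List Fm) → ℕ → S Γ → S Γ → Set
vᶜp Γ p (W₁ , _) (W₂ , _) =
  Consistent (⋀ W₁ ∧' ⟨ prg p ⟩ ⋀ W₂)

Rᶜ□ : (Γ : List Fm) → S Γ → S Γ → Set
Rᶜ□ Γ (W₁ , _) (W₂ , _) =
  Consistent (⋀ W₁ ∧' ◇ ⋀ W₂)

module Submission where

-- Reflexivity and symmetry of the canonical relation are S5 reasoning (T, and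
-- ◇ □ φ → φ).  Transitivity is semantic.  The Fischer–Ladner closure of Γ,
-- enlarged by the unfoldings ⟨ α ⟩ ¬' ¬' ⟨ β ⟩ φ through which [ α ⨟ β ] and
-- [ α * ] act, carries a finite model: its states are the complete descriptions
-- over the closure, two of them being related when they agree on boxes.  A truth
-- lemma and soundness show that related consistent descriptions b, c make
-- ⌜ b ⌝ ∧ ◇ ⌜ c ⌝ consistent.  Each canonical edge W₁ → W₂ is refined by a related
-- pair of descriptions, and two refinements of one maximal consistent set agree
-- on boxes, since the boxes of the closure lie in FL(Γ); so edges compose.  The
-- one-point model yields a first maximal consistent set.  Truth is ¬¬-stable and
-- excluded middle is only used under ¬¬, which suffices because consistency is
-- itself a negation.

open import Defs
open import Data.Bool using (Bool; true; false; not; _∨_; _∧_; T)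
open import Data.Bool.Properties using (T-∧; T-≡; ∨-zeroʳ)
open import Data.Empty using (⊥; ⊥-elim)
open import Data.Fin using (Fin; zero; suc)
open import Data.List using (List; []; _∷_; _++_; length; map; concatMap; filter)
open import Data.List.Membership.Propositional using (_∈_; find)
open import Data.List.Membership.Propositional.Properties using (∈-++⁺ˡ; ∈-++⁺ʳ; ∈-++⁻; ∈-map⁺; ∈-concatMap⁺; ∈-concatMap⁻; ∈-filter⁺; ∈-filter⁻)
open import Data.List.Relation.Unary.All as All using (All; []; _∷_)
open import Data.List.Relation.Unary.Any using (here; there; tail)
import Data.List.Relation.Unary.Any as Any
open import Data.Nat using (ℕ; zero; suc)
import Data.Nat as ℕ
open import Data.Product using (∃; ∃₂; _×_; _,_; proj₁; proj₂)
open import Data.Sum using (_⊎_; inj₁; inj₂)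
open import Data.Unit using (⊤; tt)
open import Data.Vec using (Vec; []; _∷_; lookup)
import Data.Vec as Vec
open import Data.Vec.Properties using (lookup-map)
open import Effect.Monad using (RawMonad)
open import Function using (_∘_; id; case_of_)
open import Function.Bundles using (Equivalence)
open import Level using (0ℓ)
open import Relation.Binary.Construct.Always using (Always)
import Relation.Binary.Construct.Always as Always
open import Relation.Binary.Construct.Closure.ReflexiveTransitive using (Star; ε; _◅_; _◅◅_)
open import Relation.Binary.Definitions using (Reflexive; Symmetric; Transitive)
open import Relation.Binary.PropositionalEquality using (_≡_; refl; sym; trans; cong; subst)
open import Relation.Binary.Structures using (IsEquivalence)
open import Relation.Nullary using (¬_; Dec; yes; no; does)
open import Relation.Nullary.Decidable using (map′; _×-dec_; _⊎-dec_; ¬?; ¬¬-excluded-middle)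
import Relation.Nullary.Decidable as Dec
open import Relation.Nullary.Negation using (¬¬-Monad; ¬¬-map; negated-stable)
open import Relation.Nullary.Negation.Core using (Stable)
open import Relation.Nullary.Reflects using (Reflects; ofʸ; ofⁿ; ¬-reflects; invert)

open RawMonad (¬¬-Monad {0ℓ}) using (_>>=_; pure)

infixr 40 ¬ˢ_
infixr 30 _∨ˢ_
infixr 35 _∧ˢ_
infixr 20 _⇒ˢ_

data Scheme (n : ℕ) : Set where
  var  : Fin n → Scheme n
  ⊥ˢ   : Scheme n
  ¬ˢ_  : Scheme n → Scheme n
  _∨ˢ_ : Scheme n → Scheme n → Scheme n

_⇒ˢ_ : ∀ {n} → Scheme n → Scheme n → Scheme n
p ⇒ˢ q = ¬ˢ p ∨ˢ q

_∧ˢ_ : ∀ {n} → Scheme n → Scheme n → Scheme n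
p ∧ˢ q = ¬ˢ (¬ˢ p ∨ˢ ¬ˢ q)

v₀ : ∀ {n} → Scheme (suc n)
v₀ = var zero

v₁ : ∀ {n} → Scheme (suc (suc n))
v₁ = var (suc zero)

v₂ : ∀ {n} → Scheme (suc (suc (suc n)))
v₂ = var (suc (suc zero))

v₃ : ∀ {n} → Scheme (suc (suc (suc (suc n))))
v₃ = var (suc (suc (suc zero)))

instantiate : ∀ {n} → Vec Fm n → Scheme n → Fm
instantiate σ (var i)  = lookup σ i
instantiate σ ⊥ˢ       = fal
instantiate σ (¬ˢ p)   = ¬' instantiate σ p
instantiate σ (p ∨ˢ q) = instantiate σ p ∨' instantiate σ q

evalˢ : ∀ {n} → Vec Bool n → Scheme n → Bool
evalˢ ρ (var i)  = lookup ρ i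
evalˢ ρ ⊥ˢ       = false
evalˢ ρ (¬ˢ p)   = not (evalˢ ρ p)
evalˢ ρ (p ∨ˢ q) = evalˢ ρ p ∨ evalˢ ρ q

tval-instantiate : ∀ {n} v (σ : Vec Fm n) p →
                   tval v (instantiate σ p) ≡ evalˢ (Vec.map (tval v) σ) p
tval-instantiate v σ (var i)  = sym (lookup-map i (tval v) σ)
tval-instantiate v σ ⊥ˢ       = refl
tval-instantiate v σ (¬ˢ p)   = cong not (tval-instantiate v σ p)
tval-instantiate v σ (p ∨ˢ q) =
  trans (cong (_∨ tval v (instantiate σ q)) (tval-instantiate v σ p))
        (cong (evalˢ (Vec.map (tval v) σ) p ∨_) (tval-instantiate v σ q))

all-valuations : (n : ℕ) → (Vec Bool n → Bool) → Bool
all-valuations zero    f = f []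
all-valuations (suc n) f = all-valuations n (λ ρ → f (true ∷ ρ)) ∧ all-valuations n (λ ρ → f (false ∷ ρ))

all-valuations-sound : ∀ n f → T (all-valuations n f) → ∀ ρ → T (f ρ)
all-valuations-sound zero    f h [] = h
all-valuations-sound (suc n) f h (true ∷ ρ)  = all-valuations-sound n _ (proj₁ (Equivalence.to T-∧ h)) ρ
all-valuations-sound (suc n) f h (false ∷ ρ) = all-valuations-sound n _ (proj₂ (Equivalence.to T-∧ h)) ρ

IsTautologyˢ : ∀ {n} → Scheme n → Set
IsTautologyˢ {n} p = T (all-valuations n (λ ρ → evalˢ ρ p))

⊢-scheme : ∀ {n} (p : Scheme n) {_ : IsTautologyˢ p} (σ : Vec Fm n) → ⊢ instantiate σ p
⊢-scheme {n} p {valid} σ =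
  taut (λ v → trans (tval-instantiate v σ p)
                    (Equivalence.to T-≡ (all-valuations-sound n _ valid (Vec.map (tval v) σ))))

variable
  a b c d : Fm
  π : Prg

mp₂ : ⊢ a ⇒ b ⇒ c → ⊢ a → ⊢ b → ⊢ c
mp₂ h x y = mp (mp h x) y

⇒-refl : ⊢ a ⇒ a
⇒-refl {a} = ⊢-scheme (v₀ ⇒ˢ v₀) (a ∷ [])

⇒-trans : ⊢ a ⇒ b → ⊢ b ⇒ c → ⊢ a ⇒ c
⇒-trans {a} {b} {c} = mp₂ (⊢-scheme ((v₀ ⇒ˢ v₁) ⇒ˢ (v₁ ⇒ˢ v₂) ⇒ˢ v₀ ⇒ˢ v₂) (a ∷ b ∷ c ∷ []))

⇒-∧ : ⊢ a ⇒ b → ⊢ a ⇒ c → ⊢ a ⇒ b ∧' c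
⇒-∧ {a} {b} {c} = mp₂ (⊢-scheme ((v₀ ⇒ˢ v₁) ⇒ˢ (v₀ ⇒ˢ v₂) ⇒ˢ v₀ ⇒ˢ v₁ ∧ˢ v₂) (a ∷ b ∷ c ∷ []))

∧-elimˡ : ⊢ a ∧' b ⇒ a
∧-elimˡ {a} {b} = ⊢-scheme (v₀ ∧ˢ v₁ ⇒ˢ v₀) (a ∷ b ∷ [])

∧-elimʳ : ⊢ a ∧' b ⇒ b
∧-elimʳ {a} {b} = ⊢-scheme (v₀ ∧ˢ v₁ ⇒ˢ v₁) (a ∷ b ∷ [])

∧-map : ⊢ a ⇒ c → ⊢ b ⇒ d → ⊢ a ∧' b ⇒ c ∧' d
∧-map f g = ⇒-∧ (⇒-trans ∧-elimˡ f) (⇒-trans ∧-elimʳ g)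

∧-mapʳ : ⊢ b ⇒ c → ⊢ a ∧' b ⇒ a ∧' c
∧-mapʳ = ∧-map ⇒-refl

⇔-to : ⊢ a ⇔ b → ⊢ a ⇒ b
⇔-to = mp ∧-elimˡ

⇔-from : ⊢ a ⇔ b → ⊢ b ⇒ a
⇔-from = mp ∧-elimʳ

contrapose : ⊢ a ⇒ b → ⊢ ¬' b ⇒ ¬' a
contrapose {a} {b} = mp (⊢-scheme ((v₀ ⇒ˢ v₁) ⇒ˢ ¬ˢ v₁ ⇒ˢ ¬ˢ v₀) (a ∷ b ∷ []))

¬¬-intro : ⊢ a ⇒ ¬' ¬' a
¬¬-intro {a} = ⊢-scheme (v₀ ⇒ˢ ¬ˢ ¬ˢ v₀) (a ∷ [])

¬¬-elim : ⊢ ¬' ¬' a ⇒ a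
¬¬-elim {a} = ⊢-scheme (¬ˢ ¬ˢ v₀ ⇒ˢ v₀) (a ∷ [])

¬∧-intro : ⊢ a ⇒ ¬' b → ⊢ ¬' (a ∧' b)
¬∧-intro {a} {b} = mp (⊢-scheme ((v₀ ⇒ˢ ¬ˢ v₁) ⇒ˢ ¬ˢ (v₀ ∧ˢ v₁)) (a ∷ b ∷ []))

¬∧-elim : ⊢ ¬' (a ∧' b) → ⊢ a ⇒ ¬' b
¬∧-elim {a} {b} = mp (⊢-scheme (¬ˢ (v₀ ∧ˢ v₁) ⇒ˢ v₀ ⇒ˢ ¬ˢ v₁) (a ∷ b ∷ []))

¬∨-intro : ⊢ ¬' a ⇒ ¬' b ⇒ ¬' (a ∨' b)
¬∨-intro {a} {b} = ⊢-scheme (¬ˢ v₀ ⇒ˢ ¬ˢ v₁ ⇒ˢ ¬ˢ (v₀ ∨ˢ v₁)) (a ∷ b ∷ [])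

¬∨-elimˡ : ⊢ ¬' (a ∨' b) ⇒ ¬' a
¬∨-elimˡ {a} {b} = ⊢-scheme (¬ˢ (v₀ ∨ˢ v₁) ⇒ˢ ¬ˢ v₀) (a ∷ b ∷ [])

¬∨-elimʳ : ⊢ ¬' (a ∨' b) ⇒ ¬' b
¬∨-elimʳ {a} {b} = ⊢-scheme (¬ˢ (v₀ ∨ˢ v₁) ⇒ˢ ¬ˢ v₁) (a ∷ b ∷ [])

refute : ⊢ a ⇒ b → ⊢ a ⇒ ¬' b → ⊢ ¬' a
refute {a} {b} = mp₂ (⊢-scheme ((v₀ ⇒ˢ v₁) ⇒ˢ (v₀ ⇒ˢ ¬ˢ v₁) ⇒ˢ ¬ˢ v₀) (a ∷ b ∷ []))

refute-∧ : ⊢ a ⇒ c → ⊢ b ⇒ ¬' c → ⊢ ¬' (a ∧' b)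
refute-∧ f g = refute (⇒-trans ∧-elimˡ f) (⇒-trans ∧-elimʳ g)

⇒-mp : ⊢ a ⇒ b ⇒ c → ⊢ a ⇒ b → ⊢ a ⇒ c
⇒-mp {a} {b} {c} = mp₂ (⊢-scheme ((v₀ ⇒ˢ v₁ ⇒ˢ v₂) ⇒ˢ (v₀ ⇒ˢ v₁) ⇒ˢ v₀ ⇒ˢ v₂) (a ∷ b ∷ c ∷ []))

∧-swap : ⊢ a ∧' b ⇒ b ∧' a
∧-swap = ⇒-∧ ∧-elimʳ ∧-elimˡ

⊢¬fal : ⊢ ¬' fal
⊢¬fal = ⊢-scheme (¬ˢ ⊥ˢ) []

⇒-const : ⊢ b → ⊢ a ⇒ b
⇒-const {b} {a} = mp (⊢-scheme (v₀ ⇒ˢ v₁ ⇒ˢ v₀) (b ∷ a ∷ []))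

Consistent-mono : ⊢ a ⇒ b → Consistent a → Consistent b
Consistent-mono h k ¬b = k (mp (contrapose h) ¬b)

Consistent-∧ˡ : Consistent (a ∧' b) → Consistent a
Consistent-∧ˡ = Consistent-mono ∧-elimˡ

Consistent-∧ʳ : Consistent (a ∧' b) → Consistent b
Consistent-∧ʳ = Consistent-mono ∧-elimʳ

Consistent-∨ : Consistent (a ∧' (b ∨' c)) → ¬ ¬ (Consistent (a ∧' b) ⊎ Consistent (a ∧' c))
Consistent-∨ {a} {b} {c} k ¬either = ¬either (inj₁ λ ⊢¬b → ¬either (inj₂ λ ⊢¬c → k (mp₂ ¬∧∨ ⊢¬b ⊢¬c)))
  where
  ¬∧∨ : ⊢ ¬' (a ∧' b) ⇒ ¬' (a ∧' c) ⇒ ¬' (a ∧' (b ∨' c))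
  ¬∧∨ = ⊢-scheme (¬ˢ (v₀ ∧ˢ v₁) ⇒ˢ ¬ˢ (v₀ ∧ˢ v₂) ⇒ˢ ¬ˢ (v₀ ∧ˢ (v₁ ∨ˢ v₂))) (a ∷ b ∷ c ∷ [])

¬¬-all : ∀ {A : Set} {P : A → Set} xs → (∀ {x} → x ∈ xs → ¬ ¬ P x) → ¬ ¬ All P xs
¬¬-all xs f = All.sequenceM 0ℓ ¬¬-Monad (All.tabulate f)

⋀-member : ∀ {W} → a ∈ W → ⊢ ⋀ W ⇒ a
⋀-member (here refl) = ∧-elimˡ
⋀-member (there m)   = ⇒-trans ∧-elimʳ (⋀-member m)

⇒-⋀ : ∀ {W} → (∀ {x} → x ∈ W → ⊢ a ⇒ x) → ⊢ a ⇒ ⋀ W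
⇒-⋀ {a} {[]}        f = ⊢-scheme (v₀ ⇒ˢ ¬ˢ ⊥ˢ) (a ∷ [])
⇒-⋀ {W = x ∷ W}     f = ⇒-∧ (f (here refl)) (⇒-⋀ (f ∘ there))

⋁ : List Fm → Fm
⋁ []       = fal
⋁ (x ∷ xs) = x ∨' ⋁ xs

module _ {A : Set} (f : A → Fm) where

  ⋁-intro : ∀ {x xs} → x ∈ xs → ⊢ f x ⇒ ⋁ (map f xs)
  ⋁-intro {x} {_ ∷ xs} (here refl) = ⊢-scheme (v₀ ⇒ˢ v₀ ∨ˢ v₁) (f x ∷ ⋁ (map f xs) ∷ [])
  ⋁-intro {x} {y ∷ xs} (there m)   = ⇒-trans (⋁-intro m) (⊢-scheme (v₁ ⇒ˢ v₀ ∨ˢ v₁) (f y ∷ ⋁ (map f xs) ∷ []))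

  ⋁-elim : ∀ {xs} → All (λ x → ⊢ f x ⇒ a) xs → ⊢ ⋁ (map f xs) ⇒ a
  ⋁-elim {a} []                = ⊢-scheme (⊥ˢ ⇒ˢ v₀) (a ∷ [])
  ⋁-elim {a} {x ∷ xs} (h ∷ hs) =
    mp₂ (⊢-scheme ((v₀ ⇒ˢ v₂) ⇒ˢ (v₁ ⇒ˢ v₂) ⇒ˢ v₀ ∨ˢ v₁ ⇒ˢ v₂) (f x ∷ ⋁ (map f xs) ∷ a ∷ [])) h (⋁-elim hs)

  ⋁-consistent : ∀ xs → Consistent (⋁ (map f xs)) → ¬ ¬ ∃ λ x → Consistent (f x)
  ⋁-consistent xs k ∄ = ¬¬-all xs (λ {x} _ c → ∄ (x , c)) (k ∘ refute-all)
    where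
    refute-all : ∀ {xs} → All (λ x → ⊢ ¬' f x) xs → ⊢ ¬' ⋁ (map f xs)
    refute-all []       = ⊢¬fal
    refute-all (h ∷ hs) = mp₂ ¬∨-intro h (refute-all hs)

  ∧-⋁-distrib : ∀ xs → ⊢ a ∧' ⋁ (map f xs) ⇒ ⋁ (map (λ x → a ∧' f x) xs)
  ∧-⋁-distrib []       = ∧-elimʳ
  ∧-⋁-distrib {a} (x ∷ xs) =
    mp (⊢-scheme ((v₀ ∧ˢ v₂ ⇒ˢ v₃) ⇒ˢ v₀ ∧ˢ (v₁ ∨ˢ v₂) ⇒ˢ (v₀ ∧ˢ v₁) ∨ˢ v₃)
                 (a ∷ f x ∷ ⋁ (map f xs) ∷ ⋁ (map (λ x → a ∧' f x) xs) ∷ []))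
       (∧-⋁-distrib xs)

□-mono : ⊢ a ⇒ b → ⊢ □ a ⇒ □ b
□-mono h = mp K□ (nec□ h)

◇-mono : ⊢ a ⇒ b → ⊢ ◇ a ⇒ ◇ b
◇-mono h = contrapose (□-mono (contrapose h))

[]-mono : ⊢ a ⇒ b → ⊢ [ π ] a ⇒ [ π ] b
[]-mono h = mp K[] (nec[] h)

⟨⟩¬-mono : ⊢ ¬' a ⇒ ¬' b → ⊢ ⟨ π ⟩ ¬' a ⇒ ⟨ π ⟩ ¬' b
⟨⟩¬-mono {a} {b} h = ⇒-trans ¬¬-intro (⇒-trans (contrapose ([]-mono b⇒a)) ¬¬-elim)
  where
  b⇒a : ⊢ b ⇒ a
  b⇒a = ⇒-trans ¬¬-intro (⇒-trans (contrapose h) ¬¬-elim)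

¬□⇒◇¬ : ⊢ ¬' □ a ⇒ ◇ ¬' a
¬□⇒◇¬ = contrapose (□-mono ¬¬-elim)

◇-intro : ⊢ a ⇒ ◇ a
◇-intro = ⇒-trans ¬¬-intro (contrapose T□)

¬□⇒□¬□ : ⊢ ¬' □ a ⇒ □ ¬' □ a
¬□⇒□¬□ = ⇒-trans ¬□⇒◇¬ (⇒-trans 5□ (□-mono (contrapose (□-mono ¬¬-intro))))

□⇒□□ : ⊢ □ a ⇒ □ □ a
□⇒□□ = ⇒-trans ◇-intro (⇒-trans 5□ (□-mono (⇒-trans (contrapose ¬□⇒□¬□) ¬¬-elim)))

⟨⟩¬¬-elim : ⊢ ⟨ π ⟩ ¬' ¬' ¬' a ⇒ ⟨ π ⟩ ¬' a
⟨⟩¬¬-elim = ⟨⟩¬-mono ¬¬-elim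

⟨⟩¬⇒¬[]¬ : ⊢ ⟨ π ⟩ ¬' a ⇒ ¬' [ π ] ¬' ¬' a
⟨⟩¬⇒¬[]¬ = ⇒-trans (⟨⟩¬-mono ¬¬-intro) ¬¬-intro

[⨟]⇒ : ∀ {α β} → ⊢ [ α ⨟ β ] a ⇒ [ α ] [ β ] a
[⨟]⇒ = ⇔-to ⨟ax

[∪]⇒ˡ : ∀ {α β} → ⊢ [ α ∪' β ] a ⇒ [ α ] a
[∪]⇒ˡ = ⇒-trans (⇔-to ∪ax) ∧-elimˡ

[∪]⇒ʳ : ∀ {α β} → ⊢ [ α ∪' β ] a ⇒ [ β ] a
[∪]⇒ʳ = ⇒-trans (⇔-to ∪ax) ∧-elimʳ

[*]⇒ : ⊢ [ π * ] a ⇒ a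
[*]⇒ = ⇒-trans (⇔-from *ax) ∧-elimˡ

[*]⇒[][*] : ⊢ [ π * ] a ⇒ [ π ] [ π * ] a
[*]⇒[][*] = ⇒-trans (⇔-from *ax) ∧-elimʳ

*-induction : ⊢ a ⇒ [ π ] a → ⊢ a ⇒ [ π * ] a
*-induction {a} {π} h =
  mp₂ (⊢-scheme ((v₀ ∧ˢ v₁ ⇒ˢ v₂) ⇒ˢ v₁ ⇒ˢ v₀ ⇒ˢ v₂) (a ∷ [ π * ] (a ⇒ [ π ] a) ∷ [ π * ] a ∷ []))
      ind (nec[] h)

⟨⨟⟩¬⇒ : ∀ {α β} → ⊢ ⟨ α ⨟ β ⟩ ¬' a ⇒ ⟨ α ⟩ ¬' ¬' ⟨ β ⟩ ¬' a
⟨⨟⟩¬⇒ = ⇒-trans ¬¬-intro (⇒-trans (contrapose (⇔-from ⨟ax)) ¬¬-elim)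

⟨∪⟩¬⇒ : ∀ {α β} → ⊢ ⟨ α ∪' β ⟩ ¬' a ⇒ ⟨ α ⟩ ¬' a ∨' ⟨ β ⟩ ¬' a
⟨∪⟩¬⇒ {a} {α} {β} = mp (⊢-scheme ((¬ˢ v₁ ∧ˢ ¬ˢ v₂ ⇒ˢ ¬ˢ v₀) ⇒ˢ v₀ ⇒ˢ v₁ ∨ˢ v₂)
                                  (⟨ α ∪' β ⟩ ¬' a ∷ ⟨ α ⟩ ¬' a ∷ ⟨ β ⟩ ¬' a ∷ []))
                       (⇔-from ∪ax)

⟨¿⟩¬⇒ : ∀ {χ} → ⊢ ⟨ ¿ χ ⟩ ¬' a ⇒ χ ∧' ¬' a
⟨¿⟩¬⇒ {a} {χ} = mp (⊢-scheme (((v₀ ⇒ˢ v₁) ⇒ˢ ¬ˢ v₂) ⇒ˢ v₂ ⇒ˢ v₀ ∧ˢ ¬ˢ v₁) (χ ∷ a ∷ ⟨ ¿ χ ⟩ ¬' a ∷ []))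
                   (⇔-from ?ax)

◇□⇒ : ⊢ ◇ □ a ⇒ a
◇□⇒ = ⇒-trans (contrapose (⇒-trans ◇-intro (⇒-trans (contrapose (□-mono ¬¬-intro)) ¬□⇒□¬□))) ¬¬-elim

◇-symmetric : Consistent (a ∧' ◇ b) → Consistent (b ∧' ◇ a)
◇-symmetric {a} {b} k ⊢¬[b∧◇a] = k (¬∧-intro (⇒-trans ¬¬-intro (contrapose (⇒-trans (◇-mono b⇒□¬a) ◇□⇒))))
  where
  b⇒□¬a : ⊢ b ⇒ □ ¬' a
  b⇒□¬a = ⇒-trans (¬∧-elim ⊢¬[b∧◇a]) ¬¬-elim

record NormalDiamond : Set where
  infixr 40 ◆_
  field
    ◆_     : Fm → Fm
    ◆-mono : ∀ {a b} → ⊢ a ⇒ b → ⊢ ◆ a ⇒ ◆ b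
    ◆-∨    : ∀ {a b} → ⊢ ◆ (a ∨' b) ⇒ ◆ a ∨' ◆ b
    ¬◆⊥    : ⊢ ¬' ◆ fal

  ◆-consistent : Consistent (◆ a) → Consistent a
  ◆-consistent {a} k ⊢¬a = k (mp (contrapose (◆-mono (mp (⊢-scheme (¬ˢ v₀ ⇒ˢ v₀ ⇒ˢ ⊥ˢ) (a ∷ [])) ⊢¬a))) ¬◆⊥)

  ◆-⋁ : ∀ {A : Set} (f : A → Fm) xs → ⊢ ◆ ⋁ (map f xs) ⇒ ⋁ (map (◆_ ∘ f) xs)
  ◆-⋁ f []       = mp (⊢-scheme (¬ˢ v₀ ⇒ˢ v₀ ⇒ˢ ⊥ˢ) (◆ fal ∷ [])) ¬◆⊥
  ◆-⋁ f (x ∷ xs) = ⇒-trans ◆-∨ (mp (⊢-scheme ((v₁ ⇒ˢ v₂) ⇒ˢ v₀ ∨ˢ v₁ ⇒ˢ v₀ ∨ˢ v₂)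
                                              (◆ f x ∷ ◆ ⋁ (map f xs) ∷ ⋁ (map (◆_ ∘ f) xs) ∷ []))
                                       (◆-⋁ f xs))

◇-normal : NormalDiamond
◇-normal = record { ◆_ = ◇_ ; ◆-mono = ◇-mono ; ◆-∨ = ◇-∨ ; ¬◆⊥ = mp ¬¬-intro (nec□ ⊢¬fal) }
  where
  ◇-∨ : ⊢ ◇ (a ∨' b) ⇒ ◇ a ∨' ◇ b
  ◇-∨ {a} {b} =
    mp (⊢-scheme ((v₀ ⇒ˢ v₁ ⇒ˢ v₂) ⇒ˢ ¬ˢ v₂ ⇒ˢ ¬ˢ v₀ ∨ˢ ¬ˢ v₁) (□ ¬' a ∷ □ ¬' b ∷ □ ¬' (a ∨' b) ∷ []))
       (⇒-trans (□-mono ¬∨-intro) K□)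

⟨⟩¬¬-normal : Prg → NormalDiamond
⟨⟩¬¬-normal α = record { ◆_ = λ a → ⟨ α ⟩ ¬' ¬' a ; ◆-mono = mono ; ◆-∨ = ⟨⟩¬¬-∨ ; ¬◆⊥ = nec[] ⊢¬fal }
  where
  mono : ⊢ a ⇒ b → ⊢ ⟨ α ⟩ ¬' ¬' a ⇒ ⟨ α ⟩ ¬' ¬' b
  mono h = ⟨⟩¬-mono (contrapose (contrapose h))
  ⟨⟩¬¬-∨ : ⊢ ⟨ α ⟩ ¬' ¬' (a ∨' b) ⇒ ⟨ α ⟩ ¬' ¬' a ∨' ⟨ α ⟩ ¬' ¬' b
  ⟨⟩¬¬-∨ {a} {b} =
    mp (⊢-scheme ((¬ˢ v₀ ⇒ˢ ¬ˢ v₁ ⇒ˢ ¬ˢ v₂) ⇒ˢ v₂ ⇒ˢ v₀ ∨ˢ v₁)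
                 (⟨ α ⟩ ¬' ¬' a ∷ ⟨ α ⟩ ¬' ¬' b ∷ ⟨ α ⟩ ¬' ¬' (a ∨' b) ∷ []))
       (⇒-trans ([]-mono ¬∨-intro) K[])

mutual
  _≟ᶠ_ : (φ ψ : Fm) → Dec (φ ≡ ψ)
  atm x    ≟ᶠ atm y    = map′ (cong atm) (λ { refl → refl }) (x ℕ.≟ y)
  fal      ≟ᶠ fal      = yes refl
  (¬' φ)   ≟ᶠ (¬' ψ)   = map′ (cong ¬'_) (λ { refl → refl }) (φ ≟ᶠ ψ)
  (φ ∨' χ) ≟ᶠ (ψ ∨' θ) = map′ (λ { (refl , refl) → refl }) (λ { refl → refl , refl }) (φ ≟ᶠ ψ ×-dec χ ≟ᶠ θ)
  (⟨ α ⟩ φ) ≟ᶠ (⟨ β ⟩ ψ) = map′ (λ { (refl , refl) → refl }) (λ { refl → refl , refl }) (α ≟ᵖ β ×-dec φ ≟ᶠ ψ)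
  (□ φ)    ≟ᶠ (□ ψ)    = map′ (cong □_) (λ { refl → refl }) (φ ≟ᶠ ψ)
  atm _    ≟ᶠ fal      = no λ ()
  atm _    ≟ᶠ (¬' _)   = no λ ()
  atm _    ≟ᶠ (_ ∨' _) = no λ ()
  atm _    ≟ᶠ (⟨ _ ⟩ _) = no λ ()
  atm _    ≟ᶠ (□ _)    = no λ ()
  fal      ≟ᶠ atm _    = no λ ()
  fal      ≟ᶠ (¬' _)   = no λ ()
  fal      ≟ᶠ (_ ∨' _) = no λ ()
  fal      ≟ᶠ (⟨ _ ⟩ _) = no λ ()
  fal      ≟ᶠ (□ _)    = no λ ()
  (¬' _)   ≟ᶠ atm _    = no λ ()
  (¬' _)   ≟ᶠ fal      = no λ ()
  (¬' _)   ≟ᶠ (_ ∨' _) = no λ ()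
  (¬' _)   ≟ᶠ (⟨ _ ⟩ _) = no λ ()
  (¬' _)   ≟ᶠ (□ _)    = no λ ()
  (_ ∨' _) ≟ᶠ atm _    = no λ ()
  (_ ∨' _) ≟ᶠ fal      = no λ ()
  (_ ∨' _) ≟ᶠ (¬' _)   = no λ ()
  (_ ∨' _) ≟ᶠ (⟨ _ ⟩ _) = no λ ()
  (_ ∨' _) ≟ᶠ (□ _)    = no λ ()
  (⟨ _ ⟩ _) ≟ᶠ atm _    = no λ ()
  (⟨ _ ⟩ _) ≟ᶠ fal      = no λ ()
  (⟨ _ ⟩ _) ≟ᶠ (¬' _)   = no λ ()
  (⟨ _ ⟩ _) ≟ᶠ (_ ∨' _) = no λ ()
  (⟨ _ ⟩ _) ≟ᶠ (□ _)    = no λ ()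
  (□ _)    ≟ᶠ atm _    = no λ ()
  (□ _)    ≟ᶠ fal      = no λ ()
  (□ _)    ≟ᶠ (¬' _)   = no λ ()
  (□ _)    ≟ᶠ (_ ∨' _) = no λ ()
  (□ _)    ≟ᶠ (⟨ _ ⟩ _) = no λ ()

  _≟ᵖ_ : (α β : Prg) → Dec (α ≡ β)
  prg x    ≟ᵖ prg y    = map′ (cong prg) (λ { refl → refl }) (x ℕ.≟ y)
  (α ⨟ γ)  ≟ᵖ (β ⨟ δ)  = map′ (λ { (refl , refl) → refl }) (λ { refl → refl , refl }) (α ≟ᵖ β ×-dec γ ≟ᵖ δ)
  (α ∪' γ) ≟ᵖ (β ∪' δ) = map′ (λ { (refl , refl) → refl }) (λ { refl → refl , refl }) (α ≟ᵖ β ×-dec γ ≟ᵖ δ)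
  (α *)    ≟ᵖ (β *)    = map′ (cong _*) (λ { refl → refl }) (α ≟ᵖ β)
  (¿ φ)    ≟ᵖ (¿ ψ)    = map′ (cong ¿_) (λ { refl → refl }) (φ ≟ᶠ ψ)
  prg _    ≟ᵖ (_ ⨟ _)  = no λ ()
  prg _    ≟ᵖ (_ ∪' _) = no λ ()
  prg _    ≟ᵖ (_ *)    = no λ ()
  prg _    ≟ᵖ (¿ _)    = no λ ()
  (_ ⨟ _)  ≟ᵖ prg _    = no λ ()
  (_ ⨟ _)  ≟ᵖ (_ ∪' _) = no λ ()
  (_ ⨟ _)  ≟ᵖ (_ *)    = no λ ()
  (_ ⨟ _)  ≟ᵖ (¿ _)    = no λ ()
  (_ ∪' _) ≟ᵖ prg _    = no λ ()
  (_ ∪' _) ≟ᵖ (_ ⨟ _)  = no λ ()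
  (_ ∪' _) ≟ᵖ (_ *)    = no λ ()
  (_ ∪' _) ≟ᵖ (¿ _)    = no λ ()
  (_ *)    ≟ᵖ prg _    = no λ ()
  (_ *)    ≟ᵖ (_ ⨟ _)  = no λ ()
  (_ *)    ≟ᵖ (_ ∪' _) = no λ ()
  (_ *)    ≟ᵖ (¿ _)    = no λ ()
  (¿ _)    ≟ᵖ prg _    = no λ ()
  (¿ _)    ≟ᵖ (_ ⨟ _)  = no λ ()
  (¿ _)    ≟ᵖ (_ ∪' _) = no λ ()
  (¿ _)    ≟ᵖ (_ *)    = no λ ()

-- Double-negation Kripke semantics

module Semantics {St : Set} (R□ : St → St → Set) (Vf : ℕ → St → Set)
                 (Vp : ℕ → St → St → Set) (Vfree : Prg → Fm → St → Set) where

  infix 4 _⊨_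

  mutual
    _⊨_ : St → Fm → Set
    s ⊨ atm x   = ¬ ¬ Vf x s
    s ⊨ fal     = ⊥
    s ⊨ ¬' φ    = ¬ (s ⊨ φ)
    s ⊨ φ ∨' ψ  = ¬ (¬ (s ⊨ φ) × ¬ (s ⊨ ψ))
    s ⊨ ⟨ α ⟩ φ = ¬ ¬ Witness α φ s
    s ⊨ □ φ     = ∀ t → R□ s t → t ⊨ φ

    -- Since [α] is ¬⟨α⟩¬, the axioms constrain ⟨α⟩φ only when φ is a
    -- negation; every other ⟨α⟩φ is read off an arbitrary valuation Vfree.
    Witness : Prg → Fm → St → Set
    Witness α (¬' ψ) s = ∃ λ t → ⟦ α ⟧ s t × ¬ (t ⊨ ψ)
    Witness α φ      s = Vfree α φ s

    ⟦_⟧ : Prg → St → St → Set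
    ⟦ prg p ⟧      = Vp p
    ⟦ α ⨟ β ⟧ s t  = ∃ λ u → ⟦ α ⟧ s u × ⟦ β ⟧ u t
    ⟦ α ∪' β ⟧ s t = ⟦ α ⟧ s t ⊎ ⟦ β ⟧ s t
    ⟦ α * ⟧        = Star ⟦ α ⟧
    ⟦ ¿ φ ⟧ s t    = s ≡ t × s ⊨ φ

  ⊨-stable : ∀ φ s → Stable (s ⊨ φ)
  ⊨-stable (atm x)   s = negated-stable
  ⊨-stable fal       s = λ h → h (λ ())
  ⊨-stable (¬' φ)    s = negated-stable
  ⊨-stable (φ ∨' ψ)  s = negated-stable
  ⊨-stable (⟨ α ⟩ φ) s = negated-stable
  ⊨-stable (□ φ)     s = λ h t r → ⊨-stable φ t (¬¬-map (λ f → f t r) h)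

  module _ {s : St} where

    ⊨⇒-intro : ∀ φ ψ → (s ⊨ φ → s ⊨ ψ) → s ⊨ φ ⇒ ψ
    ⊨⇒-intro φ ψ f (¬¬φ , ¬ψ) = ¬¬φ (λ x → ¬ψ (f x))

    ⊨⇒-elim : ∀ φ ψ → s ⊨ φ ⇒ ψ → s ⊨ φ → s ⊨ ψ
    ⊨⇒-elim φ ψ h x = ⊨-stable ψ s (λ ¬ψ → h ((λ ¬φ → ¬φ x) , ¬ψ))

    ⊨∧-intro : ∀ φ ψ → s ⊨ φ → s ⊨ ψ → s ⊨ φ ∧' ψ
    ⊨∧-intro φ ψ x y h = h ((λ ¬φ → ¬φ x) , (λ ¬ψ → ¬ψ y))

    ⊨∧-elimˡ : ∀ φ ψ → s ⊨ φ ∧' ψ → s ⊨ φ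
    ⊨∧-elimˡ φ ψ h = ⊨-stable φ s (λ ¬φ → h (λ p → proj₁ p ¬φ))

    ⊨∧-elimʳ : ∀ φ ψ → s ⊨ φ ∧' ψ → s ⊨ ψ
    ⊨∧-elimʳ φ ψ h = ⊨-stable ψ s (λ ¬ψ → h (λ p → proj₂ p ¬ψ))

    ⊨⇔-intro : ∀ φ ψ → (s ⊨ φ → s ⊨ ψ) → (s ⊨ ψ → s ⊨ φ) → s ⊨ φ ⇔ ψ
    ⊨⇔-intro φ ψ f g = ⊨∧-intro (φ ⇒ ψ) (ψ ⇒ φ) (⊨⇒-intro φ ψ f) (⊨⇒-intro ψ φ g)

    ⊨[]-intro : ∀ α φ → (∀ t → ⟦ α ⟧ s t → t ⊨ φ) → s ⊨ [ α ] φ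
    ⊨[]-intro α φ f h = h (λ (t , r , ¬φ) → ¬φ (f t r))

    ⊨[]-elim : ∀ α φ {t} → s ⊨ [ α ] φ → ⟦ α ⟧ s t → t ⊨ φ
    ⊨[]-elim α φ {t} h r = ⊨-stable φ t (λ ¬φ → h (λ k → k (t , r , ¬φ)))

  prop-atoms : Fm → List Fm
  prop-atoms fal      = []
  prop-atoms (¬' φ)   = prop-atoms φ
  prop-atoms (φ ∨' ψ) = prop-atoms φ ++ prop-atoms ψ
  prop-atoms φ        = φ ∷ []

  ∨-reflects : ∀ {A B : Set} {x y} → Reflects A x → Reflects B y → Reflects (¬ (¬ A × ¬ B)) (x ∨ y)
  ∨-reflects (ofʸ a)  _        = ofʸ (λ (¬a , _) → ¬a a)
  ∨-reflects (ofⁿ ¬a) (ofʸ b)  = ofʸ (λ (_ , ¬b) → ¬b b)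
  ∨-reflects (ofⁿ ¬a) (ofⁿ ¬b) = ofⁿ (λ h → h (¬a , ¬b))

  tval-reflects : ∀ {s} v φ → (∀ {ψ} → ψ ∈ prop-atoms φ → Reflects (s ⊨ ψ) (v ψ)) →
                  Reflects (s ⊨ φ) (tval v φ)
  tval-reflects v (atm x)   r = r (here refl)
  tval-reflects v fal       r = ofⁿ (λ ())
  tval-reflects v (¬' φ)    r = ¬-reflects (tval-reflects v φ r)
  tval-reflects v (φ ∨' ψ)  r = ∨-reflects (tval-reflects v φ (r ∘ ∈-++⁺ˡ))
                                          (tval-reflects v ψ (r ∘ ∈-++⁺ʳ (prop-atoms φ)))
  tval-reflects v (⟨ α ⟩ φ) r = r (here refl)
  tval-reflects v (□ φ)     r = r (here refl)

  valuation : ∀ {s xs} → All (λ ψ → Dec (s ⊨ ψ)) xs → Fm → Bool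
  valuation []                  ψ = false
  valuation {xs = x ∷ _} (d ∷ ds) ψ with ψ ≟ᶠ x
  ... | yes _ = does d
  ... | no _  = valuation ds ψ

  valuation-reflects : ∀ {s xs} (ds : All (λ ψ → Dec (s ⊨ ψ)) xs) {ψ} → ψ ∈ xs →
                       Reflects (s ⊨ ψ) (valuation ds ψ)
  valuation-reflects {xs = x ∷ _} (d ∷ ds) {ψ} m with ψ ≟ᶠ x
  ... | yes refl = Dec.proof d
  ... | no ψ≢x   = valuation-reflects ds (tail ψ≢x m)

  tautology-sound : ∀ {φ} → Tautology φ → ∀ s → s ⊨ φ
  tautology-sound {φ} taut-φ s = ⊨-stable φ s (¬¬-map holds decided)
    where
    decided : ¬ ¬ All (λ ψ → Dec (s ⊨ ψ)) (prop-atoms φ)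
    decided = ¬¬-all (prop-atoms φ) (λ _ → ¬¬-excluded-middle)
    holds : All (λ ψ → Dec (s ⊨ ψ)) (prop-atoms φ) → s ⊨ φ
    holds ds = invert (subst (Reflects (s ⊨ φ)) (taut-φ (valuation ds))
                             (tval-reflects (valuation ds) φ (valuation-reflects ds)))

  module Soundness (R□-equivalence : IsEquivalence R□)
                   (vp⊆R□ : ∀ p {s t} → Vp p s t → R□ s t)
                   (free⇒◇ : ∀ α φ s → Vfree α φ s → s ⊨ ◇ φ) where

    open IsEquivalence R□-equivalence renaming (refl to R□-refl; sym to R□-sym; trans to R□-trans)

    ⟦⟧⊆R□ : ∀ α {s t} → ⟦ α ⟧ s t → R□ s t
    ⟦⟧⊆R□ (prg p)  r              = vp⊆R□ p r
    ⟦⟧⊆R□ (α ⨟ β)  (_ , r₁ , r₂)  = R□-trans (⟦⟧⊆R□ α r₁) (⟦⟧⊆R□ β r₂)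
    ⟦⟧⊆R□ (α ∪' β) (inj₁ r)       = ⟦⟧⊆R□ α r
    ⟦⟧⊆R□ (α ∪' β) (inj₂ r)       = ⟦⟧⊆R□ β r
    ⟦⟧⊆R□ (α *)    ε              = R□-refl
    ⟦⟧⊆R□ (α *)    (r ◅ rs)       = R□-trans (⟦⟧⊆R□ α r) (⟦⟧⊆R□ (α *) rs)
    ⟦⟧⊆R□ (¿ φ)    (refl , _)     = R□-refl

    ⊨⟨⟩⇒◇ : ∀ α φ s → s ⊨ ⟨ α ⟩ φ → s ⊨ ◇ φ
    ⊨⟨⟩⇒◇ α (¬' ψ)    s w □¬¬ψ = w (λ (t , r , ¬ψ) → □¬¬ψ t (⟦⟧⊆R□ α r) ¬ψ)
    ⊨⟨⟩⇒◇ α (atm x)   s w = ⊨-stable (◇ atm x) s (¬¬-map (free⇒◇ α _ s) w)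
    ⊨⟨⟩⇒◇ α fal       s w = ⊨-stable (◇ fal) s (¬¬-map (free⇒◇ α _ s) w)
    ⊨⟨⟩⇒◇ α (φ ∨' ψ)  s w = ⊨-stable (◇ (φ ∨' ψ)) s (¬¬-map (free⇒◇ α _ s) w)
    ⊨⟨⟩⇒◇ α (⟨ β ⟩ φ) s w = ⊨-stable (◇ ⟨ β ⟩ φ) s (¬¬-map (free⇒◇ α _ s) w)
    ⊨⟨⟩⇒◇ α (□ φ)     s w = ⊨-stable (◇ □ φ) s (¬¬-map (free⇒◇ α _ s) w)

    ⊨K[] : ∀ α φ ψ s → s ⊨ [ α ] (φ ⇒ ψ) ⇒ ([ α ] φ ⇒ [ α ] ψ)
    ⊨K[] α φ ψ s =
      ⊨⇒-intro ([ α ] (φ ⇒ ψ)) ([ α ] φ ⇒ [ α ] ψ) λ h₁ →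
      ⊨⇒-intro ([ α ] φ) ([ α ] ψ) λ h₂ →
      ⊨[]-intro α ψ λ t r → ⊨⇒-elim φ ψ (⊨[]-elim α (φ ⇒ ψ) h₁ r) (⊨[]-elim α φ h₂ r)

    ⊨∧[] : ∀ α φ ψ s → s ⊨ [ α ] (φ ∧' ψ) ⇔ ([ α ] φ ∧' [ α ] ψ)
    ⊨∧[] α φ ψ s =
      ⊨⇔-intro ([ α ] (φ ∧' ψ)) ([ α ] φ ∧' [ α ] ψ)
        (λ h → ⊨∧-intro ([ α ] φ) ([ α ] ψ)
                 (⊨[]-intro α φ λ t r → ⊨∧-elimˡ φ ψ (⊨[]-elim α (φ ∧' ψ) h r))
                 (⊨[]-intro α ψ λ t r → ⊨∧-elimʳ φ ψ (⊨[]-elim α (φ ∧' ψ) h r)))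
        (λ h → ⊨[]-intro α (φ ∧' ψ) λ t r →
                 ⊨∧-intro φ ψ (⊨[]-elim α φ (⊨∧-elimˡ ([ α ] φ) ([ α ] ψ) h) r)
                              (⊨[]-elim α ψ (⊨∧-elimʳ ([ α ] φ) ([ α ] ψ) h) r))

    ⊨∪ax : ∀ α β φ s → s ⊨ [ α ∪' β ] φ ⇔ ([ α ] φ ∧' [ β ] φ)
    ⊨∪ax α β φ s =
      ⊨⇔-intro ([ α ∪' β ] φ) ([ α ] φ ∧' [ β ] φ)
        (λ h → ⊨∧-intro ([ α ] φ) ([ β ] φ)
                 (⊨[]-intro α φ λ t r → ⊨[]-elim (α ∪' β) φ h (inj₁ r))
                 (⊨[]-intro β φ λ t r → ⊨[]-elim (α ∪' β) φ h (inj₂ r)))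
        (λ h → ⊨[]-intro (α ∪' β) φ λ
                 { t (inj₁ r) → ⊨[]-elim α φ (⊨∧-elimˡ ([ α ] φ) ([ β ] φ) h) r
                 ; t (inj₂ r) → ⊨[]-elim β φ (⊨∧-elimʳ ([ α ] φ) ([ β ] φ) h) r })

    ⊨?ax : ∀ φ ψ s → s ⊨ [ ¿ φ ] ψ ⇔ (φ ⇒ ψ)
    ⊨?ax φ ψ s =
      ⊨⇔-intro ([ ¿ φ ] ψ) (φ ⇒ ψ)
        (λ h → ⊨⇒-intro φ ψ λ x → ⊨[]-elim (¿ φ) ψ h (refl , x))
        (λ h → ⊨[]-intro (¿ φ) ψ λ { t (refl , x) → ⊨⇒-elim φ ψ h x })

    ⊨⨟ax : ∀ α β φ s → s ⊨ [ α ⨟ β ] φ ⇔ [ α ] [ β ] φ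
    ⊨⨟ax α β φ s =
      ⊨⇔-intro ([ α ⨟ β ] φ) ([ α ] [ β ] φ)
        (λ h → ⊨[]-intro α ([ β ] φ) λ u r₁ → ⊨[]-intro β φ λ t r₂ → ⊨[]-elim (α ⨟ β) φ h (u , r₁ , r₂))
        (λ h → ⊨[]-intro (α ⨟ β) φ λ { t (u , r₁ , r₂) → ⊨[]-elim β φ (⊨[]-elim α ([ β ] φ) h r₁) r₂ })

    ⊨*ax : ∀ α φ s → s ⊨ (φ ∧' [ α ] [ α * ] φ) ⇔ [ α * ] φ
    ⊨*ax α φ s =
      ⊨⇔-intro (φ ∧' [ α ] [ α * ] φ) ([ α * ] φ)
        (λ h → ⊨[]-intro (α *) φ λ
                 { t ε        → ⊨∧-elimˡ φ ([ α ] [ α * ] φ) h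
                 ; t (r ◅ rs) → ⊨[]-elim (α *) φ (⊨[]-elim α ([ α * ] φ) (⊨∧-elimʳ φ ([ α ] [ α * ] φ) h) r)
                                         rs })
        (λ h → ⊨∧-intro φ ([ α ] [ α * ] φ) (⊨[]-elim (α *) φ h ε)
                 (⊨[]-intro α ([ α * ] φ) λ u r → ⊨[]-intro (α *) φ λ t rs → ⊨[]-elim (α *) φ h (r ◅ rs)))

    ⊨ind : ∀ α φ s → s ⊨ (φ ∧' [ α * ] (φ ⇒ [ α ] φ)) ⇒ [ α * ] φ
    ⊨ind α φ s =
      ⊨⇒-intro (φ ∧' [ α * ] step) ([ α * ] φ) λ h →
      ⊨[]-intro (α *) φ λ t → invariant (⊨∧-elimˡ φ ([ α * ] step) h) (⊨∧-elimʳ φ ([ α * ] step) h)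
      where
      step : Fm
      step = φ ⇒ [ α ] φ
      invariant : ∀ {s t} → s ⊨ φ → s ⊨ [ α * ] step → ⟦ α * ⟧ s t → t ⊨ φ
      invariant x h ε        = x
      invariant x h (r ◅ rs) =
        invariant (⊨[]-elim α φ (⊨⇒-elim φ ([ α ] φ) (⊨[]-elim (α *) step h ε) x) r)
                  (⊨[]-intro (α *) step λ u rs′ → ⊨[]-elim (α *) step h (r ◅ rs′)) rs

    sound : ∀ {φ} → ⊢ φ → ∀ s → s ⊨ φ
    sound (taut t)              = tautology-sound t
    sound (K[] {α} {φ} {ψ})     = ⊨K[] α φ ψ
    sound (∧[] {α} {φ} {ψ})     = ⊨∧[] α φ ψ
    sound (∪ax {α} {β} {φ})     = ⊨∪ax α β φ
    sound (?ax {φ} {ψ})         = ⊨?ax φ ψ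
    sound (⨟ax {α} {β} {φ})     = ⊨⨟ax α β φ
    sound (*ax {α} {φ})         = ⊨*ax α φ
    sound (ind {α} {φ})         = ⊨ind α φ
    sound (K□ {φ} {ψ}) s        =
      ⊨⇒-intro (□ (φ ⇒ ψ)) (□ φ ⇒ □ ψ) λ h₁ → ⊨⇒-intro (□ φ) (□ ψ) λ h₂ t r → ⊨⇒-elim φ ψ (h₁ t r) (h₂ t r)
    sound (T□ {φ}) s            = ⊨⇒-intro (□ φ) φ λ h → h s R□-refl
    sound (5□ {φ}) s            =
      ⊨⇒-intro (◇ φ) (□ ◇ φ) λ h u r ⊨□¬φ → h (λ t r′ → ⊨□¬φ t (R□-trans (R□-sym r) r′))
    sound (⟨⟩◇ {α} {φ}) s       = ⊨⇒-intro (⟨ α ⟩ φ) (◇ φ) (⊨⟨⟩⇒◇ α φ s)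
    sound (mp {φ} {ψ} d e) s    = ⊨⇒-elim φ ψ (sound d s) (sound e s)
    sound (nec[] {α} {φ} d) s   = ⊨[]-intro α φ λ t _ → sound d t
    sound (nec□ d) s            = λ t _ → sound d t

data Kind : Set where
  plain boxed : Kind

mutual
  closure : Kind → Fm → List Fm
  closure k (atm x)   = atm x ∷ []
  closure k fal       = fal ∷ []
  closure k (¬' φ)    = ¬' φ ∷ closure k φ
  closure k (φ ∨' ψ)  = φ ∨' ψ ∷ closure k φ ++ closure k ψ
  closure k (⟨ α ⟩ φ) = closureᵈ k α φ ++ closure k φ
  closure k (□ φ)     = □ φ ∷ closure k φ

  closureᵈ : Kind → Prg → Fm → List Fm
  closureᵈ k (prg p)  φ = ⟨ prg p ⟩ φ ∷ []
  closureᵈ k (α ⨟ β)  φ = ⟨ α ⨟ β ⟩ φ ∷ closureᵈ k α (⟨ β ⟩ φ) ++ unfolding¬¬ k α (⟨ β ⟩ φ) ++ closureᵈ k β φ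
  closureᵈ k (α ∪' β) φ = ⟨ α ∪' β ⟩ φ ∷ closureᵈ k α φ ++ closureᵈ k β φ
  closureᵈ k (α *)    φ = ⟨ α * ⟩ φ ∷ closureᵈ k α (⟨ α * ⟩ φ) ++ closureᵈ k α φ ++ unfolding¬¬ k α (⟨ α * ⟩ φ)
  closureᵈ k (¿ ψ)    φ = ⟨ ¿ ψ ⟩ φ ∷ closure k ψ

  unfolding¬¬ : Kind → Prg → Fm → List Fm
  unfolding¬¬ plain α θ = []
  unfolding¬¬ boxed α θ = closureᵈ boxed α (¬' ¬' θ) ++ ¬' ¬' θ ∷ ¬' θ ∷ []

-- With [ α ] ψ = ¬' ⟨ α ⟩ ¬' ψ, the axiom for [ α ⨟ β ] produces ⟨ α ⟩ ¬' ¬' ⟨ β ⟩ ¬' ψ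
-- rather than ⟨ α ⟩ ⟨ β ⟩ ¬' ψ; the boxed closure also contains these unfoldings (and those of α *).
data Step : Kind → Fm → Fm → Set where
  s¬   : ∀ {k φ} → Step k (¬' φ) φ
  s∨₁  : ∀ {k φ ψ} → Step k (φ ∨' ψ) φ
  s∨₂  : ∀ {k φ ψ} → Step k (φ ∨' ψ) ψ
  s⟨⟩  : ∀ {k α φ} → Step k (⟨ α ⟩ φ) φ
  s□   : ∀ {k φ} → Step k (□ φ) φ
  s¿   : ∀ {k ψ φ} → Step k (⟨ ¿ ψ ⟩ φ) ψ
  s⨟   : ∀ {k α β φ} → Step k (⟨ α ⨟ β ⟩ φ) (⟨ α ⟩ ⟨ β ⟩ φ)
  s∪₁  : ∀ {k α β φ} → Step k (⟨ α ∪' β ⟩ φ) (⟨ α ⟩ φ)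
  s∪₂  : ∀ {k α β φ} → Step k (⟨ α ∪' β ⟩ φ) (⟨ β ⟩ φ)
  s*₁  : ∀ {k α φ} → Step k (⟨ α * ⟩ φ) (⟨ α ⟩ φ)
  s*₂  : ∀ {k α φ} → Step k (⟨ α * ⟩ φ) (⟨ α ⟩ ⟨ α * ⟩ φ)
  s⨟¬¬ : ∀ {α β φ} → Step boxed (⟨ α ⨟ β ⟩ φ) (⟨ α ⟩ ¬' ¬' ⟨ β ⟩ φ)
  s*¬¬ : ∀ {α φ} → Step boxed (⟨ α * ⟩ φ) (⟨ α ⟩ ¬' ¬' ⟨ α * ⟩ φ)

Closed : Kind → List Fm → Set
Closed k L = ∀ {φ ψ} → φ ∈ L → Step k φ ψ → ψ ∈ L

∈-closureᵈ : ∀ k α φ → ⟨ α ⟩ φ ∈ closureᵈ k α φ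
∈-closureᵈ k (prg p)  φ = here refl
∈-closureᵈ k (α ⨟ β)  φ = here refl
∈-closureᵈ k (α ∪' β) φ = here refl
∈-closureᵈ k (α *)    φ = here refl
∈-closureᵈ k (¿ ψ)    φ = here refl

∈-closure : ∀ k φ → φ ∈ closure k φ
∈-closure k (atm x)   = here refl
∈-closure k fal       = here refl
∈-closure k (¬' φ)    = here refl
∈-closure k (φ ∨' ψ)  = here refl
∈-closure k (⟨ α ⟩ φ) = ∈-++⁺ˡ (∈-closureᵈ k α φ)
∈-closure k (□ φ)     = here refl

mutual
  closure-closed : ∀ k φ → Closed k (closure k φ)
  closure-closed k (atm x)   (here refl) ()
  closure-closed k fal       (here refl) ()
  closure-closed k (¬' φ)    (here refl) s¬  = there (∈-closure k φ)
  closure-closed k (¬' φ)    (there m)   s   = there (closure-closed k φ m s)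
  closure-closed k (φ ∨' ψ)  (here refl) s∨₁ = there (∈-++⁺ˡ (∈-closure k φ))
  closure-closed k (φ ∨' ψ)  (here refl) s∨₂ = there (∈-++⁺ʳ (closure k φ) (∈-closure k ψ))
  closure-closed k (φ ∨' ψ)  (there m)   s with ∈-++⁻ (closure k φ) m
  ... | inj₁ m′ = there (∈-++⁺ˡ (closure-closed k φ m′ s))
  ... | inj₂ m′ = there (∈-++⁺ʳ (closure k φ) (closure-closed k ψ m′ s))
  closure-closed k (⟨ α ⟩ φ) m s with ∈-++⁻ (closureᵈ k α φ) m
  ... | inj₂ m′ = ∈-++⁺ʳ (closureᵈ k α φ) (closure-closed k φ m′ s)
  ... | inj₁ m′ with closureᵈ-closed k α φ m′ s
  ...   | inj₁ m″   = ∈-++⁺ˡ m″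
  ...   | inj₂ refl = ∈-++⁺ʳ (closureᵈ k α φ) (∈-closure k φ)
  closure-closed k (□ φ)     (here refl) s□  = there (∈-closure k φ)
  closure-closed k (□ φ)     (there m)   s   = there (closure-closed k φ m s)

  closureᵈ-closed : ∀ k α φ {χ ψ} → χ ∈ closureᵈ k α φ → Step k χ ψ → ψ ∈ closureᵈ k α φ ⊎ ψ ≡ φ
  closureᵈ-closed k (prg p)  φ (here refl) s⟨⟩ = inj₂ refl
  closureᵈ-closed k (α ⨟ β)  φ (here refl) s⟨⟩ = inj₂ refl
  closureᵈ-closed k (α ⨟ β)  φ (here refl) s⨟  = inj₁ (there (∈-++⁺ˡ (∈-closureᵈ k α _)))
  closureᵈ-closed k (α ⨟ β)  φ (here refl) s⨟¬¬ =
    inj₁ (there (∈-++⁺ʳ (closureᵈ k α (⟨ β ⟩ φ)) (∈-++⁺ˡ (∈-++⁺ˡ (∈-closureᵈ k α _)))))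
  closureᵈ-closed k (α ⨟ β)  φ (there m) s with ∈-++⁻ (closureᵈ k α (⟨ β ⟩ φ)) m
  ... | inj₁ m₁ with closureᵈ-closed k α (⟨ β ⟩ φ) m₁ s
  ...   | inj₁ m′   = inj₁ (there (∈-++⁺ˡ m′))
  ...   | inj₂ refl = inj₁ (there (∈-++⁺ʳ (closureᵈ k α (⟨ β ⟩ φ))
                                   (∈-++⁺ʳ (unfolding¬¬ k α (⟨ β ⟩ φ)) (∈-closureᵈ k β φ))))
  closureᵈ-closed k (α ⨟ β)  φ (there m) s | inj₂ m₂ with ∈-++⁻ (unfolding¬¬ k α (⟨ β ⟩ φ)) m₂
  ... | inj₁ m₃ with unfolding¬¬-closed k α (⟨ β ⟩ φ) m₃ s
  ...   | inj₁ m′   = inj₁ (there (∈-++⁺ʳ (closureᵈ k α (⟨ β ⟩ φ)) (∈-++⁺ˡ m′)))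
  ...   | inj₂ refl = inj₁ (there (∈-++⁺ʳ (closureᵈ k α (⟨ β ⟩ φ))
                                   (∈-++⁺ʳ (unfolding¬¬ k α (⟨ β ⟩ φ)) (∈-closureᵈ k β φ))))
  closureᵈ-closed k (α ⨟ β)  φ (there m) s | inj₂ m₂ | inj₂ m₃ with closureᵈ-closed k β φ m₃ s
  ... | inj₁ m′ = inj₁ (there (∈-++⁺ʳ (closureᵈ k α (⟨ β ⟩ φ)) (∈-++⁺ʳ (unfolding¬¬ k α (⟨ β ⟩ φ)) m′)))
  ... | inj₂ e  = inj₂ e
  closureᵈ-closed k (α ∪' β) φ (here refl) s⟨⟩ = inj₂ refl
  closureᵈ-closed k (α ∪' β) φ (here refl) s∪₁ = inj₁ (there (∈-++⁺ˡ (∈-closureᵈ k α φ)))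
  closureᵈ-closed k (α ∪' β) φ (here refl) s∪₂ = inj₁ (there (∈-++⁺ʳ (closureᵈ k α φ) (∈-closureᵈ k β φ)))
  closureᵈ-closed k (α ∪' β) φ (there m) s with ∈-++⁻ (closureᵈ k α φ) m
  ... | inj₁ m₁ with closureᵈ-closed k α φ m₁ s
  ...   | inj₁ m′ = inj₁ (there (∈-++⁺ˡ m′))
  ...   | inj₂ e  = inj₂ e
  closureᵈ-closed k (α ∪' β) φ (there m) s | inj₂ m₂ with closureᵈ-closed k β φ m₂ s
  ...   | inj₁ m′ = inj₁ (there (∈-++⁺ʳ (closureᵈ k α φ) m′))
  ...   | inj₂ e  = inj₂ e
  closureᵈ-closed k (α *)    φ (here refl) s⟨⟩ = inj₂ refl
  closureᵈ-closed k (α *)    φ (here refl) s*₁ =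
    inj₁ (there (∈-++⁺ʳ (closureᵈ k α (⟨ α * ⟩ φ)) (∈-++⁺ˡ (∈-closureᵈ k α φ))))
  closureᵈ-closed k (α *)    φ (here refl) s*₂ = inj₁ (there (∈-++⁺ˡ (∈-closureᵈ k α _)))
  closureᵈ-closed k (α *)    φ (here refl) s*¬¬ =
    inj₁ (there (∈-++⁺ʳ (closureᵈ k α (⟨ α * ⟩ φ)) (∈-++⁺ʳ (closureᵈ k α φ) (∈-++⁺ˡ (∈-closureᵈ k α _)))))
  closureᵈ-closed k (α *)    φ (there m) s with ∈-++⁻ (closureᵈ k α (⟨ α * ⟩ φ)) m
  ... | inj₁ m₁ with closureᵈ-closed k α (⟨ α * ⟩ φ) m₁ s
  ...   | inj₁ m′   = inj₁ (there (∈-++⁺ˡ m′))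
  ...   | inj₂ refl = inj₁ (here refl)
  closureᵈ-closed k (α *)    φ (there m) s | inj₂ m₂ with ∈-++⁻ (closureᵈ k α φ) m₂
  ... | inj₁ m₃ with closureᵈ-closed k α φ m₃ s
  ...   | inj₁ m′ = inj₁ (there (∈-++⁺ʳ (closureᵈ k α (⟨ α * ⟩ φ)) (∈-++⁺ˡ m′)))
  ...   | inj₂ e  = inj₂ e
  closureᵈ-closed k (α *)    φ (there m) s | inj₂ m₂ | inj₂ m₃ with unfolding¬¬-closed k α (⟨ α * ⟩ φ) m₃ s
  ... | inj₁ m′   = inj₁ (there (∈-++⁺ʳ (closureᵈ k α (⟨ α * ⟩ φ)) (∈-++⁺ʳ (closureᵈ k α φ) m′)))
  ... | inj₂ refl = inj₁ (here refl)
  closureᵈ-closed k (¿ ψ)    φ (here refl) s⟨⟩ = inj₂ refl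
  closureᵈ-closed k (¿ ψ)    φ (here refl) s¿  = inj₁ (there (∈-closure k ψ))
  closureᵈ-closed k (¿ ψ)    φ (there m)   s   = inj₁ (there (closure-closed k ψ m s))

  unfolding¬¬-closed : ∀ k α θ {χ ψ} → χ ∈ unfolding¬¬ k α θ → Step k χ ψ → ψ ∈ unfolding¬¬ k α θ ⊎ ψ ≡ θ
  unfolding¬¬-closed boxed α θ m s with ∈-++⁻ (closureᵈ boxed α (¬' ¬' θ)) m
  ... | inj₁ m′ with closureᵈ-closed boxed α (¬' ¬' θ) m′ s
  ...   | inj₁ m″   = inj₁ (∈-++⁺ˡ m″)
  ...   | inj₂ refl = inj₁ (∈-++⁺ʳ (closureᵈ boxed α (¬' ¬' θ)) (here refl))
  unfolding¬¬-closed boxed α θ m s¬ | inj₂ (here refl)         =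
    inj₁ (∈-++⁺ʳ (closureᵈ boxed α (¬' ¬' θ)) (there (here refl)))
  unfolding¬¬-closed boxed α θ m s¬ | inj₂ (there (here refl)) = inj₂ refl

closureₗ : Kind → List Fm → List Fm
closureₗ k = concatMap (closure k)

closureₗ-closed : ∀ k Γ → Closed k (closureₗ k Γ)
closureₗ-closed k Γ m s =
  ∈-concatMap⁺ (closure k) {Γ} (Any.map (λ {φ} m′ → closure-closed k φ m′ s) (∈-concatMap⁻ (closure k) {Γ} m))

FL⇒∈closureₗ : ∀ k {Γ φ} → FL Γ φ → φ ∈ closureₗ k Γ
FL⇒∈closureₗ k {Γ} (base m)  = ∈-concatMap⁺ (closure k) {Γ} (Any.map (λ { refl → ∈-closure k _ }) m)
FL⇒∈closureₗ k {Γ} (sub¬ d)  = closureₗ-closed k Γ (FL⇒∈closureₗ k d) s¬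
FL⇒∈closureₗ k {Γ} (sub∨₁ d) = closureₗ-closed k Γ (FL⇒∈closureₗ k d) s∨₁
FL⇒∈closureₗ k {Γ} (sub∨₂ d) = closureₗ-closed k Γ (FL⇒∈closureₗ k d) s∨₂
FL⇒∈closureₗ k {Γ} (sub⟨⟩ d) = closureₗ-closed k Γ (FL⇒∈closureₗ k d) s⟨⟩
FL⇒∈closureₗ k {Γ} (sub□ d)  = closureₗ-closed k Γ (FL⇒∈closureₗ k d) s□
FL⇒∈closureₗ k {Γ} (test d)  = closureₗ-closed k Γ (FL⇒∈closureₗ k d) s¿
FL⇒∈closureₗ k {Γ} (seq d)   = closureₗ-closed k Γ (FL⇒∈closureₗ k d) s⨟
FL⇒∈closureₗ k {Γ} (cup₁ d)  = closureₗ-closed k Γ (FL⇒∈closureₗ k d) s∪₁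
FL⇒∈closureₗ k {Γ} (cup₂ d)  = closureₗ-closed k Γ (FL⇒∈closureₗ k d) s∪₂
FL⇒∈closureₗ k {Γ} (star₁ d) = closureₗ-closed k Γ (FL⇒∈closureₗ k d) s*₁
FL⇒∈closureₗ k {Γ} (star₂ d) = closureₗ-closed k Γ (FL⇒∈closureₗ k d) s*₂

mutual
  closure⊆FL : ∀ {Γ} φ {χ} → χ ∈ closure plain φ → FL Γ φ → FL Γ χ
  closure⊆FL (atm x)   (here refl) d = d
  closure⊆FL fal       (here refl) d = d
  closure⊆FL (¬' φ)    (here refl) d = d
  closure⊆FL (¬' φ)    (there m)   d = closure⊆FL φ m (sub¬ d)
  closure⊆FL (φ ∨' ψ)  (here refl) d = d
  closure⊆FL (φ ∨' ψ)  (there m)   d with ∈-++⁻ (closure plain φ) m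
  ... | inj₁ m′ = closure⊆FL φ m′ (sub∨₁ d)
  ... | inj₂ m′ = closure⊆FL ψ m′ (sub∨₂ d)
  closure⊆FL (⟨ α ⟩ φ) m d with ∈-++⁻ (closureᵈ plain α φ) m
  ... | inj₁ m′ = closureᵈ⊆FL α φ m′ d
  ... | inj₂ m′ = closure⊆FL φ m′ (sub⟨⟩ d)
  closure⊆FL (□ φ)     (here refl) d = d
  closure⊆FL (□ φ)     (there m)   d = closure⊆FL φ m (sub□ d)

  closureᵈ⊆FL : ∀ {Γ} α φ {χ} → χ ∈ closureᵈ plain α φ → FL Γ (⟨ α ⟩ φ) → FL Γ χ
  closureᵈ⊆FL (prg p)  φ (here refl) d = d
  closureᵈ⊆FL (α ⨟ β)  φ (here refl) d = d
  closureᵈ⊆FL (α ⨟ β)  φ (there m)   d with ∈-++⁻ (closureᵈ plain α (⟨ β ⟩ φ)) m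
  ... | inj₁ m′ = closureᵈ⊆FL α (⟨ β ⟩ φ) m′ (seq d)
  ... | inj₂ m′ = closureᵈ⊆FL β φ m′ (sub⟨⟩ (seq d))
  closureᵈ⊆FL (α ∪' β) φ (here refl) d = d
  closureᵈ⊆FL (α ∪' β) φ (there m)   d with ∈-++⁻ (closureᵈ plain α φ) m
  ... | inj₁ m′ = closureᵈ⊆FL α φ m′ (cup₁ d)
  ... | inj₂ m′ = closureᵈ⊆FL β φ m′ (cup₂ d)
  closureᵈ⊆FL (α *)    φ (here refl) d = d
  closureᵈ⊆FL (α *)    φ (there m)   d with ∈-++⁻ (closureᵈ plain α (⟨ α * ⟩ φ)) m
  ... | inj₁ m′ = closureᵈ⊆FL α (⟨ α * ⟩ φ) m′ (star₂ d)
  ... | inj₂ m′ with ∈-++⁻ (closureᵈ plain α φ) m′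
  ...   | inj₁ m″ = closureᵈ⊆FL α φ m″ (star₁ d)
  ...   | inj₂ ()
  closureᵈ⊆FL (¿ ψ)    φ (here refl) d = d
  closureᵈ⊆FL (¿ ψ)    φ (there m)   d = closure⊆FL ψ m (test d)

closureₗ⊆FL : ∀ Γ {χ} → χ ∈ closureₗ plain Γ → FL Γ χ
closureₗ⊆FL Γ m with find (∈-concatMap⁻ (closure plain) {Γ} m)
... | φ , φ∈Γ , χ∈cl = closure⊆FL φ χ∈cl (base φ∈Γ)

mutual
  □∈closure : ∀ φ {ψ} → □ ψ ∈ closure boxed φ → □ ψ ∈ closure plain φ
  □∈closure (atm x)   (here ())
  □∈closure (atm x)   (there ())
  □∈closure fal       (here ())
  □∈closure fal       (there ())
  □∈closure (¬' φ)    (there m) = there (□∈closure φ m)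
  □∈closure (φ ∨' ψ)  (there m) with ∈-++⁻ (closure boxed φ) m
  ... | inj₁ m′ = there (∈-++⁺ˡ (□∈closure φ m′))
  ... | inj₂ m′ = there (∈-++⁺ʳ (closure plain φ) (□∈closure ψ m′))
  □∈closure (⟨ α ⟩ φ) m with ∈-++⁻ (closureᵈ boxed α φ) m
  ... | inj₁ m′ = ∈-++⁺ˡ (□∈closureᵈ α φ φ m′)
  ... | inj₂ m′ = ∈-++⁺ʳ (closureᵈ plain α φ) (□∈closure φ m′)
  □∈closure (□ φ)     (here refl) = here refl
  □∈closure (□ φ)     (there m)   = there (□∈closure φ m)

  -- The boxes of closureᵈ k α φ come from the tests of α only, hence do not depend on φ.
  □∈closureᵈ : ∀ α φ φ′ {ψ} → □ ψ ∈ closureᵈ boxed α φ → □ ψ ∈ closureᵈ plain α φ′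
  □∈closureᵈ (prg p)  φ φ′ (there ())
  □∈closureᵈ (α ⨟ β)  φ φ′ (there m) with ∈-++⁻ (closureᵈ boxed α (⟨ β ⟩ φ)) m
  ... | inj₁ m′ = there (∈-++⁺ˡ (□∈closureᵈ α _ (⟨ β ⟩ φ′) m′))
  ... | inj₂ m′ with ∈-++⁻ (unfolding¬¬ boxed α (⟨ β ⟩ φ)) m′
  ...   | inj₂ m″ = there (∈-++⁺ʳ (closureᵈ plain α (⟨ β ⟩ φ′)) (□∈closureᵈ β φ φ′ m″))
  ...   | inj₁ m″ with ∈-++⁻ (closureᵈ boxed α (¬' ¬' ⟨ β ⟩ φ)) m″
  ...     | inj₁ m‴ = there (∈-++⁺ˡ (□∈closureᵈ α _ (⟨ β ⟩ φ′) m‴))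
  ...     | inj₂ (there (there ()))
  □∈closureᵈ (α ∪' β) φ φ′ (there m) with ∈-++⁻ (closureᵈ boxed α φ) m
  ... | inj₁ m′ = there (∈-++⁺ˡ (□∈closureᵈ α φ φ′ m′))
  ... | inj₂ m′ = there (∈-++⁺ʳ (closureᵈ plain α φ′) (□∈closureᵈ β φ φ′ m′))
  □∈closureᵈ (α *)    φ φ′ (there m) with ∈-++⁻ (closureᵈ boxed α (⟨ α * ⟩ φ)) m
  ... | inj₁ m′ = there (∈-++⁺ˡ (□∈closureᵈ α _ (⟨ α * ⟩ φ′) m′))
  ... | inj₂ m′ with ∈-++⁻ (closureᵈ boxed α φ) m′
  ...   | inj₁ m″ = there (∈-++⁺ʳ (closureᵈ plain α (⟨ α * ⟩ φ′)) (∈-++⁺ˡ (□∈closureᵈ α φ φ′ m″)))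
  ...   | inj₂ m″ with ∈-++⁻ (closureᵈ boxed α (¬' ¬' ⟨ α * ⟩ φ)) m″
  ...     | inj₁ m‴ = there (∈-++⁺ˡ (□∈closureᵈ α _ (⟨ α * ⟩ φ′) m‴))
  ...     | inj₂ (there (there ()))
  □∈closureᵈ (¿ ψ)    φ φ′ (there m) = there (□∈closure ψ m)

□∈closureₗ⇒FL : ∀ Γ {ψ} → □ ψ ∈ closureₗ boxed Γ → FL Γ (□ ψ)
□∈closureₗ⇒FL Γ m with find (∈-concatMap⁻ (closure boxed) {Γ} m)
... | φ , φ∈Γ , □ψ∈cl = closure⊆FL φ (□∈closure φ □ψ∈cl) (base φ∈Γ)

literal : Bool → Fm → Fm
literal true  φ = φ
literal false φ = ¬' φ

literals : (xs : List Fm) → Vec Bool (length xs) → List Fm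
literals []       []       = []
literals (x ∷ xs) (b ∷ bs) = literal b x ∷ literals xs bs

∈-literals : ∀ xs bs {x} → x ∈ xs → x ∈ literals xs bs ⊎ ¬' x ∈ literals xs bs
∈-literals (x ∷ xs) (true ∷ bs)  (here refl) = inj₁ (here refl)
∈-literals (x ∷ xs) (false ∷ bs) (here refl) = inj₂ (here refl)
∈-literals (y ∷ xs) (b ∷ bs)     (there m) with ∈-literals xs bs m
... | inj₁ m′ = inj₁ (there m′)
... | inj₂ m′ = inj₂ (there m′)

literals-injective : ∀ xs bs cs → Consistent (⋀ (literals xs bs) ∧' ⋀ (literals xs cs)) → bs ≡ cs
literals-injective []       []           []           k = refl
literals-injective (x ∷ xs) (true ∷ bs)  (true ∷ cs)  k =
  cong (true ∷_) (literals-injective xs bs cs (Consistent-mono (∧-map ∧-elimʳ ∧-elimʳ) k))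
literals-injective (x ∷ xs) (false ∷ bs) (false ∷ cs) k =
  cong (false ∷_) (literals-injective xs bs cs (Consistent-mono (∧-map ∧-elimʳ ∧-elimʳ) k))
literals-injective (x ∷ xs) (true ∷ bs)  (false ∷ cs) k = ⊥-elim (k (refute-∧ ∧-elimˡ ∧-elimˡ))
literals-injective (x ∷ xs) (false ∷ bs) (true ∷ cs)  k = ⊥-elim (k (refute-∧ ∧-elimˡ (⇒-trans ∧-elimˡ ¬¬-intro)))

bits : (Fm → Bool) → (xs : List Fm) → Vec Bool (length xs)
bits v []       = []
bits v (x ∷ xs) = tval v x ∷ bits v xs

tval-literal : ∀ v x → tval v (literal (tval v x) x) ≡ true
tval-literal v x with tval v x in eq
... | true  = eq
... | false = cong not eq

tval-⋀-literals : ∀ v xs → tval v (⋀ (literals xs (bits v xs))) ≡ true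
tval-⋀-literals v []       = refl
tval-⋀-literals v (x ∷ xs) rewrite tval-literal v x | tval-⋀-literals v xs = refl

all-vectors : (n : ℕ) → List (Vec Bool n)
all-vectors zero    = [] ∷ []
all-vectors (suc n) = map (true ∷_) (all-vectors n) ++ map (false ∷_) (all-vectors n)

∈-all-vectors : ∀ {n} (bs : Vec Bool n) → bs ∈ all-vectors n
∈-all-vectors []           = here refl
∈-all-vectors (true ∷ bs)  = ∈-++⁺ˡ (∈-map⁺ (true ∷_) (∈-all-vectors bs))
∈-all-vectors (false ∷ bs) = ∈-++⁺ʳ (map (true ∷_) (all-vectors _)) (∈-map⁺ (false ∷_) (∈-all-vectors bs))

module Descriptions (L : List Fm) where

  State : Set
  State = Vec Bool (length L)

  -- Written as a negation so that ⟨ α ⟩ ⌜ c ⌝ is interpreted by the accessibility relation.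
  ⌜_⌝ : State → Fm
  ⌜ b ⌝ = ¬' ¬' ⋀ (literals L b)

  states : List State
  states = all-vectors (length L)

  decides : ∀ {φ} → φ ∈ L → ∀ b → (⊢ ⌜ b ⌝ ⇒ φ) ⊎ (⊢ ⌜ b ⌝ ⇒ ¬' φ)
  decides m b with ∈-literals L b m
  ... | inj₁ m′ = inj₁ (⇒-trans ¬¬-elim (⋀-member m′))
  ... | inj₂ m′ = inj₂ (⇒-trans ¬¬-elim (⋀-member m′))

  ⌜⌝-injective : ∀ {b c} → Consistent (⌜ b ⌝ ∧' ⌜ c ⌝) → b ≡ c
  ⌜⌝-injective {b} {c} k = literals-injective L b c (Consistent-mono (∧-map ¬¬-elim ¬¬-elim) k)

  ⊢⋁states : ⊢ ⋁ (map ⌜_⌝ states)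
  ⊢⋁states = taut (λ v → satisfied v (∈-all-vectors (bits v L)) (cong (not ∘ not) (tval-⋀-literals v L)))
    where
    satisfied : ∀ v {b} {bs} → b ∈ bs → tval v ⌜ b ⌝ ≡ true → tval v (⋁ (map ⌜_⌝ bs)) ≡ true
    satisfied v (here refl) h rewrite h = refl
    satisfied v {bs = b′ ∷ _} (there m) h rewrite satisfied v m h = ∨-zeroʳ (tval v ⌜ b′ ⌝)

  ¬¬-decidable : (P : State → Set) → ¬ ¬ (∀ t → Dec (P t))
  ¬¬-decidable P = ¬¬-map (λ ds t → All.lookup ds (∈-all-vectors t)) (¬¬-all states (λ _ → ¬¬-excluded-middle))

  ⇒⋁-descriptions : ⊢ a ⇒ ⋁ (map (λ c → a ∧' ⌜ c ⌝) states)
  ⇒⋁-descriptions = ⇒-trans (⇒-∧ ⇒-refl (⇒-const ⊢⋁states)) (∧-⋁-distrib ⌜_⌝ states)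

  consistent-description : Consistent a → ¬ ¬ ∃ λ b → Consistent (a ∧' ⌜ b ⌝)
  consistent-description k = ⋁-consistent _ states (Consistent-mono ⇒⋁-descriptions k)

  module _ (D : NormalDiamond) where
    open NormalDiamond D

    diamond-witness : ∀ {a A} → Consistent (a ∧' ◆ A) →
                      ¬ ¬ ∃ λ c → Consistent (a ∧' ◆ ⌜ c ⌝) × Consistent (A ∧' ⌜ c ⌝)
    diamond-witness {a} {A} k = do
      (c , k′) ← ⋁-consistent _ states (Consistent-mono (⇒-trans spread (∧-⋁-distrib _ states)) k)
      pure (c , Consistent-mono (∧-mapʳ (◆-mono ∧-elimʳ)) k′ , ◆-consistent (Consistent-∧ʳ k′))
      where
      spread : ⊢ a ∧' ◆ A ⇒ a ∧' ⋁ (map (λ c → ◆ (A ∧' ⌜ c ⌝)) states)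
      spread = ∧-mapʳ (⇒-trans (◆-mono ⇒⋁-descriptions) (◆-⋁ _ states))

module FiniteModel (L : List Fm) (L-closed : Closed boxed L) where

  open Descriptions L public

  AgreeOnBoxes : State → State → Set
  AgreeOnBoxes b c = ∀ {φ} → □ φ ∈ L → (⊢ ⌜ b ⌝ ⇒ □ φ → ⊢ ⌜ c ⌝ ⇒ □ φ) × (⊢ ⌜ c ⌝ ⇒ □ φ → ⊢ ⌜ b ⌝ ⇒ □ φ)

  -- Inconsistent descriptions are related only to themselves: this keeps _∼_ an
  -- equivalence, while the truth lemma below holds at consistent states only.
  _∼_ : State → State → Set
  b ∼ c = b ≡ c ⊎ (Consistent ⌜ b ⌝ × Consistent ⌜ c ⌝ × AgreeOnBoxes b c)

  ∼-isEquivalence : IsEquivalence _∼_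
  ∼-isEquivalence = record { refl = inj₁ refl ; sym = ∼-sym ; trans = ∼-trans }
    where
    ∼-sym : ∀ {b c} → b ∼ c → c ∼ b
    ∼-sym (inj₁ refl)             = inj₁ refl
    ∼-sym (inj₂ (kb , kc , agree)) = inj₂ (kc , kb , λ m → proj₂ (agree m) , proj₁ (agree m))
    ∼-trans : ∀ {b c d} → b ∼ c → c ∼ d → b ∼ d
    ∼-trans (inj₁ refl) r                                   = r
    ∼-trans r@(inj₂ _) (inj₁ refl)                          = r
    ∼-trans (inj₂ (kb , _ , agree)) (inj₂ (_ , kd , agree′)) =
      inj₂ (kb , kd , λ m → proj₁ (agree′ m) ∘ proj₁ (agree m) , proj₂ (agree m) ∘ proj₂ (agree′ m))

  ◇⇒∼ : ∀ {b c} → Consistent (⌜ b ⌝ ∧' ◇ ⌜ c ⌝) → b ∼ c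
  ◇⇒∼ {b} {c} k = inj₂ (Consistent-∧ˡ k , NormalDiamond.◆-consistent ◇-normal (Consistent-∧ʳ k) , agree)
    where
    agree : AgreeOnBoxes b c
    agree {φ} m = b⇒c , c⇒b
      where
      b⇒c : ⊢ ⌜ b ⌝ ⇒ □ φ → ⊢ ⌜ c ⌝ ⇒ □ φ
      b⇒c h with decides m c
      ... | inj₁ h′ = h′
      ... | inj₂ h′ = ⊥-elim (k (refute-∧ (⇒-trans h (⇒-trans □⇒□□ (□-mono ¬¬-intro))) (◇-mono h′)))
      c⇒b : ⊢ ⌜ c ⌝ ⇒ □ φ → ⊢ ⌜ b ⌝ ⇒ □ φ
      c⇒b h with decides m b
      ... | inj₁ h′ = h′
      ... | inj₂ h′ = ⊥-elim (k (refute-∧ (⇒-trans h′ ¬□⇒□¬□) (◇-mono h)))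

  Vf : ℕ → State → Set
  Vf x b = ⊢ ⌜ b ⌝ ⇒ atm x

  Vp : ℕ → State → State → Set
  Vp p b c = Consistent (⌜ b ⌝ ∧' ⟨ prg p ⟩ ⌜ c ⌝)

  Vfree : Prg → Fm → State → Set
  Vfree α φ b = ⟨ α ⟩ φ ∈ L × Consistent ⌜ b ⌝ × (⊢ ⌜ b ⌝ ⇒ ⟨ α ⟩ φ)

  open Semantics _∼_ Vf Vp Vfree public

  Truth : State → Fm → Set
  Truth b φ = (⊢ ⌜ b ⌝ ⇒ φ → b ⊨ φ) × (⊢ ⌜ b ⌝ ⇒ ¬' φ → ¬ (b ⊨ φ))

  Truth-¬ : ∀ {b φ} → Truth b φ → Truth b (¬' φ)
  Truth-¬ (⊢⇒⊨ , ⊢¬⇒⊭) = ⊢¬⇒⊭ , λ h ¬⊨ → ¬⊨ (⊢⇒⊨ (⇒-trans h ¬¬-elim))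

  module _ {φ b} (m : φ ∈ L) (T : Truth b φ) where

    ⊭⇒⊢¬ : ¬ (b ⊨ φ) → ⊢ ⌜ b ⌝ ⇒ ¬' φ
    ⊭⇒⊢¬ ⊭ with decides m b
    ... | inj₁ h = ⊥-elim (⊭ (proj₁ T h))
    ... | inj₂ h = h

    consistent⇒⊨ : Consistent (φ ∧' ⌜ b ⌝) → b ⊨ φ
    consistent⇒⊨ k with decides m b
    ... | inj₁ h = proj₁ T h
    ... | inj₂ h = ⊥-elim (k (refute-∧ ⇒-refl h))

    consistent⇒⊭ : Consistent (¬' φ ∧' ⌜ b ⌝) → ¬ (b ⊨ φ)
    consistent⇒⊭ k with decides m b
    ... | inj₁ h = ⊥-elim (k (refute-∧ ⇒-refl (⇒-trans h ¬¬-intro)))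
    ... | inj₂ h = proj₂ T h

  -- If c is not reachable from b, the induction axiom makes the disjunction of the
  -- descriptions of the states reachable from b an [ α * ]-invariant of ⌜ b ⌝ excluding ⌜ c ⌝.
  realised-* : ∀ {α b c} → (∀ {t u} → Consistent (⌜ t ⌝ ∧' ⟨ α ⟩ ⌜ u ⌝) → ¬ ¬ ⟦ α ⟧ t u) →
               Consistent (⌜ b ⌝ ∧' ⟨ α * ⟩ ⌜ c ⌝) → ¬ ¬ ⟦ α * ⟧ b c
  realised-* {α} {b} {c} realised k = do
    reachable? ← ¬¬-decidable (⟦ α * ⟧ b)
    case reachable? c of λ where
      (yes b⇝c) → pure b⇝c
      (no ¬b⇝c) → λ _ → unreachable-refuted reachable? ¬b⇝c
    where
    unreachable-refuted : (∀ t → Dec (⟦ α * ⟧ b t)) → ¬ ⟦ α * ⟧ b c → ⊥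
    unreachable-refuted reachable? ¬b⇝c =
      ¬¬-all reachable (excludes-c ∘ reached) λ ⊢excludes-c →
      ¬¬-all reachable (α-closed ∘ reached) λ ⊢α-closed →
      k (refute-∧ (⇒-trans (⋁-intro ⌜_⌝ (is-reachable ε))
                           (⇒-trans (*-induction (⋁-elim ⌜_⌝ ⊢α-closed)) ([]-mono (⋁-elim ⌜_⌝ ⊢excludes-c))))
                  ⟨⟩¬⇒¬[]¬)
      where
      reachable : List State
      reachable = filter reachable? states
      is-reachable : ∀ {t} → ⟦ α * ⟧ b t → t ∈ reachable
      is-reachable = ∈-filter⁺ reachable? (∈-all-vectors _)
      reached : ∀ {t} → t ∈ reachable → ⟦ α * ⟧ b t
      reached m = proj₂ (∈-filter⁻ reachable? {xs = states} m)
      excludes-c : ∀ {t} → ⟦ α * ⟧ b t → ¬ ¬ (⊢ ⌜ t ⌝ ⇒ ¬' ⌜ c ⌝)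
      excludes-c b⇝t ¬h = ¬b⇝c (subst (⟦ α * ⟧ b) (⌜⌝-injective (¬h ∘ ¬∧-elim)) b⇝t)
      α-closed : ∀ {t} → ⟦ α * ⟧ b t → ¬ ¬ (⊢ ⌜ t ⌝ ⇒ [ α ] ⋁ (map ⌜_⌝ reachable))
      α-closed b⇝t ¬h =
        diamond-witness (⟨⟩¬¬-normal α) (Consistent-mono (∧-mapʳ (⟨⟩¬-mono ¬¬-intro)) (¬h ∘ ¬∧-elim))
          λ (u , k₁ , k₂) → realised (Consistent-mono (∧-mapʳ ⟨⟩¬¬-elim) k₁)
          λ t⇝u → k₂ (refute-∧ ⇒-refl (⇒-trans (⋁-intro ⌜_⌝ (is-reachable (b⇝t ◅◅ t⇝u ◅ ε))) ¬¬-intro))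

  mutual
    truth : ∀ φ → φ ∈ L → ∀ b → Consistent ⌜ b ⌝ → Truth b φ
    truth (atm x)          m b k = (λ h ¬v → ¬v h) , (λ h ¬¬v → ¬¬v (λ h′ → k (refute h′ h)))
    truth fal              m b k = (λ h → k (refute h (⇒-const ⊢¬fal))) , (λ _ ())
    truth (¬' φ)           m b k = Truth-¬ (truth φ (L-closed m s¬) b k)
    truth (φ ∨' ψ)         m b k = truth-∨ φ ψ m b k
    truth (□ φ)            m b k = truth-□ φ m b k
    truth (⟨ α ⟩ ¬' ψ)     m b k = truth-⟨⟩¬ α ψ m b k
    truth (⟨ α ⟩ atm x)    m b k = truth-free m k
    truth (⟨ α ⟩ fal)      m b k = truth-free m k
    truth (⟨ α ⟩ (φ ∨' ψ)) m b k = truth-free m k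
    truth (⟨ α ⟩ ⟨ β ⟩ φ)  m b k = truth-free m k
    truth (⟨ α ⟩ □ φ)      m b k = truth-free m k

    truth-∨ : ∀ φ ψ → φ ∨' ψ ∈ L → ∀ b → Consistent ⌜ b ⌝ → Truth b (φ ∨' ψ)
    truth-∨ φ ψ m b k = ⊢⇒⊨ , ⊢¬⇒⊭
      where
      mφ : φ ∈ L
      mφ = L-closed m s∨₁
      mψ : ψ ∈ L
      mψ = L-closed m s∨₂
      ⊢⇒⊨ : ⊢ ⌜ b ⌝ ⇒ φ ∨' ψ → b ⊨ φ ∨' ψ
      ⊢⇒⊨ h (⊭φ , ⊭ψ) =
        k (refute h (⇒-mp (⇒-trans (⊭⇒⊢¬ mφ (truth φ mφ b k) ⊭φ) ¬∨-intro) (⊭⇒⊢¬ mψ (truth ψ mψ b k) ⊭ψ)))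
      ⊢¬⇒⊭ : ⊢ ⌜ b ⌝ ⇒ ¬' (φ ∨' ψ) → ¬ (b ⊨ φ ∨' ψ)
      ⊢¬⇒⊭ h ⊨φ∨ψ =
        ⊨φ∨ψ (proj₂ (truth φ mφ b k) (⇒-trans h ¬∨-elimˡ) , proj₂ (truth ψ mψ b k) (⇒-trans h ¬∨-elimʳ))

    truth-□ : ∀ φ → □ φ ∈ L → ∀ b → Consistent ⌜ b ⌝ → Truth b (□ φ)
    truth-□ φ m b k = ⊢⇒⊨ , ⊢¬⇒⊭
      where
      mφ : φ ∈ L
      mφ = L-closed m s□
      ⊢⇒⊨ : ⊢ ⌜ b ⌝ ⇒ □ φ → b ⊨ □ φ
      ⊢⇒⊨ h t (inj₁ refl)             = proj₁ (truth φ mφ b k) (⇒-trans h T□)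
      ⊢⇒⊨ h t (inj₂ (_ , kt , agree)) = proj₁ (truth φ mφ t kt) (⇒-trans (proj₁ (agree m) h) T□)
      ⊢¬⇒⊭ : ⊢ ⌜ b ⌝ ⇒ ¬' □ φ → ¬ (b ⊨ □ φ)
      ⊢¬⇒⊭ h ⊨□φ = diamond-witness ◇-normal (Consistent-mono (⇒-∧ ⇒-refl (⇒-trans h ¬□⇒◇¬)) k)
        λ (c , k₁ , k₂) → consistent⇒⊭ mφ (truth φ mφ c (Consistent-∧ʳ k₂)) k₂ (⊨□φ c (◇⇒∼ k₁))

    truth-⟨⟩¬ : ∀ α ψ → ⟨ α ⟩ ¬' ψ ∈ L → ∀ b → Consistent ⌜ b ⌝ → Truth b (⟨ α ⟩ ¬' ψ)
    truth-⟨⟩¬ α ψ m b k = ⊢⇒⊨ , ⊢¬⇒⊭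
      where
      mψ : ψ ∈ L
      mψ = L-closed (L-closed m s⟨⟩) s¬
      ⊢⇒⊨ : ⊢ ⌜ b ⌝ ⇒ ⟨ α ⟩ ¬' ψ → b ⊨ ⟨ α ⟩ ¬' ψ
      ⊢⇒⊨ h = do
        (c , k₁ , k₂) ← diamond-witness (⟨⟩¬¬-normal α)
                          (Consistent-mono (⇒-∧ ⇒-refl (⇒-trans h (⟨⟩¬-mono ¬¬-intro))) k)
        b⇝c ← realised α m (Consistent-mono (∧-mapʳ ⟨⟩¬¬-elim) k₁)
        pure (c , b⇝c , consistent⇒⊭ mψ (truth ψ mψ c (Consistent-∧ʳ k₂)) k₂)
      ⊢¬⇒⊭ : ⊢ ⌜ b ⌝ ⇒ ¬' ⟨ α ⟩ ¬' ψ → ¬ (b ⊨ ⟨ α ⟩ ¬' ψ)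
      ⊢¬⇒⊭ h ⊨⟨α⟩¬ψ = ⊨⟨α⟩¬ψ λ (t , b⇝t , ⊭ψ) →
        let (kt , ht) = []-transfer α m k h b⇝t in ⊭ψ (proj₁ (truth ψ mψ t kt) ht)

    truth-free : ∀ {α φ b} → ⟨ α ⟩ φ ∈ L → Consistent ⌜ b ⌝ →
                 (⊢ ⌜ b ⌝ ⇒ ⟨ α ⟩ φ → ¬ ¬ Vfree α φ b) × (⊢ ⌜ b ⌝ ⇒ ¬' ⟨ α ⟩ φ → ¬ ¬ ¬ Vfree α φ b)
    truth-free m k = (λ h ¬w → ¬w (m , k , h)) , (λ h ¬¬w → ¬¬w λ (_ , _ , h′) → k (refute h′ h))

    []-transfer : ∀ α {ψ b t} → ⟨ α ⟩ ¬' ψ ∈ L → Consistent ⌜ b ⌝ → ⊢ ⌜ b ⌝ ⇒ [ α ] ψ → ⟦ α ⟧ b t →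
                  Consistent ⌜ t ⌝ × (⊢ ⌜ t ⌝ ⇒ ψ)
    []-transfer (prg p) {ψ} {b} {t} m k h b⇝t = kt , ht
      where
      kt : Consistent ⌜ t ⌝
      kt ⊢¬t = b⇝t (refute-∧ (⇒-const (nec[] ⊢¬t)) ⟨⟩¬⇒¬[]¬)
      ht : ⊢ ⌜ t ⌝ ⇒ ψ
      ht with decides (L-closed (L-closed m s⟨⟩) s¬) t
      ... | inj₁ h′ = h′
      ... | inj₂ h′ = ⊥-elim (b⇝t (refute-∧ h (⇒-trans (⟨⟩¬-mono h′) ¬¬-intro)))
    []-transfer (α ⨟ β)  m k h (u , b⇝u , u⇝t) =
      let (ku , hu) = []-transfer α (L-closed m s⨟¬¬) k (⇒-trans h [⨟]⇒) b⇝u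
      in []-transfer β (L-closed (L-closed m s⨟) s⟨⟩) ku hu u⇝t
    []-transfer (α ∪' β) m k h (inj₁ b⇝t) = []-transfer α (L-closed m s∪₁) k (⇒-trans h [∪]⇒ˡ) b⇝t
    []-transfer (α ∪' β) m k h (inj₂ b⇝t) = []-transfer β (L-closed m s∪₂) k (⇒-trans h [∪]⇒ʳ) b⇝t
    []-transfer (¿ χ) {b = b} m k h (refl , ⊨χ) with decides (L-closed m s¿) b
    ... | inj₁ hχ = k , ⇒-mp (⇒-trans h (⇔-to ?ax)) hχ
    ... | inj₂ h¬χ = ⊥-elim (proj₂ (truth χ (L-closed m s¿) b k) h¬χ ⊨χ)
    []-transfer (α *) m k h ε = k , ⇒-trans h [*]⇒
    []-transfer (α *) m k h (b⇝u ◅ u⇝t) =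
      let (ku , hu) = []-transfer α (L-closed m s*¬¬) k (⇒-trans h [*]⇒[][*]) b⇝u
      in []-transfer (α *) m ku hu u⇝t

    realised : ∀ α {γ b c} → ⟨ α ⟩ γ ∈ L → Consistent (⌜ b ⌝ ∧' ⟨ α ⟩ ⌜ c ⌝) → ¬ ¬ ⟦ α ⟧ b c
    realised (prg p) m k = pure k
    realised (α ⨟ β) m k = do
      (u , k₁ , k₂) ← diamond-witness (⟨⟩¬¬-normal α) (Consistent-mono (∧-mapʳ ⟨⨟⟩¬⇒) k)
      b⇝u ← realised α (L-closed m s⨟) (Consistent-mono (∧-mapʳ ⟨⟩¬¬-elim) k₁)
      u⇝c ← realised β (L-closed (L-closed m s⨟) s⟨⟩) (Consistent-mono ∧-swap k₂)
      pure (u , b⇝u , u⇝c)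
    realised (α ∪' β) m k = do
      inj₁ k₁ ← Consistent-∨ (Consistent-mono (∧-mapʳ ⟨∪⟩¬⇒) k)
        where inj₂ k₂ → ¬¬-map inj₂ (realised β (L-closed m s∪₂) k₂)
      ¬¬-map inj₁ (realised α (L-closed m s∪₁) k₁)
    realised (¿ χ) {b = b} m k with decides (L-closed m s¿) b
    ... | inj₁ hχ = pure (⌜⌝-injective (Consistent-mono (∧-mapʳ (⇒-trans ⟨¿⟩¬⇒ ∧-elimʳ)) k)
                         , proj₁ (truth χ (L-closed m s¿) b (Consistent-∧ˡ k)) hχ)
    ... | inj₂ h¬χ = ⊥-elim (k (refute-∧ h¬χ (⇒-trans ⟨¿⟩¬⇒ (⇒-trans ∧-elimˡ ¬¬-intro))))
    realised (α *) m k = realised-* (realised α (L-closed m s*₁)) k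

  ⊨⌜⌝ : ∀ b → Consistent ⌜ b ⌝ → b ⊨ ⌜ b ⌝
  ⊨⌜⌝ b k ⊭ = ⊭ (⊨literals L b id ¬¬-elim)
    where
    Truth-literal : ∀ {x} β → Truth b x → Truth b (literal β x)
    Truth-literal true  T = T
    Truth-literal false T = Truth-¬ T
    ⊨literals : ∀ xs bs → (∀ {x} → x ∈ xs → x ∈ L) → ⊢ ⌜ b ⌝ ⇒ ⋀ (literals xs bs) → b ⊨ ⋀ (literals xs bs)
    ⊨literals []       []       _   _ = λ ()
    ⊨literals (x ∷ xs) (β ∷ bs) sub h =
      ⊨∧-intro (literal β x) (⋀ (literals xs bs))
        (proj₁ (Truth-literal β (truth x (sub (here refl)) b k)) (⇒-trans h ∧-elimˡ))
        (⊨literals xs bs (sub ∘ there) (⇒-trans h ∧-elimʳ))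

  vp⊆∼ : ∀ p {b c} → Vp p b c → b ∼ c
  vp⊆∼ p k = ◇⇒∼ (Consistent-mono (∧-mapʳ ⟨⟩◇) k)

  free⇒◇ : ∀ α φ b → Vfree α φ b → b ⊨ ◇ φ
  free⇒◇ α φ b (m , k , h) ⊨□¬φ = diamond-witness ◇-normal (Consistent-mono (⇒-∧ ⇒-refl (⇒-trans h ⟨⟩◇)) k)
    λ (c , k₁ , k₂) → ⊨□¬φ c (◇⇒∼ k₁) (consistent⇒⊨ mφ (truth φ mφ c (Consistent-∧ʳ k₂)) k₂)
    where
    mφ : φ ∈ L
    mφ = L-closed m s⟨⟩

  open Soundness ∼-isEquivalence vp⊆∼ free⇒◇

  ∼⇒◇-consistent : ∀ {b c} → b ∼ c → Consistent ⌜ b ⌝ → Consistent ⌜ c ⌝ → Consistent (⌜ b ⌝ ∧' ◇ ⌜ c ⌝)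
  ∼⇒◇-consistent {b} {c} b∼c kb kc ⊢¬ =
    sound ⊢¬ b (⊨∧-intro ⌜ b ⌝ (◇ ⌜ c ⌝) (⊨⌜⌝ b kb) λ ⊨□¬c → ⊨□¬c c b∼c (⊨⌜⌝ c kc))

MCS-absorbs : ∀ {Γ W φ} → MCS Γ W → FL± Γ φ → Consistent (φ ∧' ⋀ W) → φ ∈ W
MCS-absorbs {W = W} {φ} mcs f k = MCS.maximal mcs (φ ∷ W) (f ∷ MCS.inFL± mcs) there k (here refl)

literals-FL± : ∀ {Γ} xs bs → (∀ {x} → x ∈ xs → FL Γ x) → All (FL± Γ) (literals xs bs)
literals-FL± []       []           fl = []
literals-FL± (x ∷ xs) (true ∷ bs)  fl = inj₁ (fl (here refl)) ∷ literals-FL± xs bs (fl ∘ there)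
literals-FL± (x ∷ xs) (false ∷ bs) fl = inj₂ (x , fl (here refl) , refl) ∷ literals-FL± xs bs (fl ∘ there)

literals-MCS : ∀ {Γ} bs → Consistent (⋀ (literals (closureₗ plain Γ) bs)) →
               MCS Γ (literals (closureₗ plain Γ) bs)
literals-MCS {Γ} bs k = record
  { inFL± = literals-FL± (closureₗ plain Γ) bs (closureₗ⊆FL Γ) ; consistent = k ; maximal = maximal }
  where
  W : List Fm
  W = literals (closureₗ plain Γ) bs
  maximal : (V : List Fm) → All (FL± Γ) V → W ⊆ V → Consistent (⋀ V) → V ⊆ W
  maximal V fl W⊆V kV m with All.lookup fl m
  ... | inj₁ f with ∈-literals (closureₗ plain Γ) bs (FL⇒∈closureₗ plain f)
  ...   | inj₁ x∈W  = x∈W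
  ...   | inj₂ ¬x∈W = ⊥-elim (kV (refute (⋀-member m) (⋀-member (W⊆V ¬x∈W))))
  maximal V fl W⊆V kV m | inj₂ (ψ , f , refl) with ∈-literals (closureₗ plain Γ) bs (FL⇒∈closureₗ plain f)
  ...   | inj₁ ψ∈W  = ⊥-elim (kV (refute (⋀-member (W⊆V ψ∈W)) (⋀-member m)))
  ...   | inj₂ ¬ψ∈W = ¬ψ∈W

module OnePoint where

  R□ : ⊤ → ⊤ → Set
  R□ = Always

  Vf : ℕ → ⊤ → Set
  Vf _ _ = ⊥

  Vp : ℕ → ⊤ → ⊤ → Set
  Vp _ _ _ = ⊥

  Vfree : Prg → Fm → ⊤ → Set
  Vfree _ _ _ = ⊥

  open Semantics R□ Vf Vp Vfree

  vp⊆R□ : ∀ p {s t} → Vp p s t → R□ s t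
  vp⊆R□ p ()

  free⇒◇ : ∀ α φ s → Vfree α φ s → s ⊨ ◇ φ
  free⇒◇ α φ s ()

  open Soundness (Always.isEquivalence ⊤ 0ℓ) vp⊆R□ free⇒◇

  mutual
    ⊨? : ∀ φ → Dec (tt ⊨ φ)
    ⊨? (atm x)          = no (λ ⊨x → ⊨x (λ ()))
    ⊨? fal              = no (λ ())
    ⊨? (¬' φ)           = ¬? (⊨? φ)
    ⊨? (φ ∨' ψ)         = ¬? (¬? (⊨? φ) ×-dec ¬? (⊨? ψ))
    ⊨? (⟨ α ⟩ ¬' ψ)     = ¬? (¬? (map′ (tt ,_) proj₂ (⟦ α ⟧? ×-dec ¬? (⊨? ψ))))
    ⊨? (⟨ α ⟩ atm x)    = no (λ ⊨⟨α⟩ → ⊨⟨α⟩ (λ ()))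
    ⊨? (⟨ α ⟩ fal)      = no (λ ⊨⟨α⟩ → ⊨⟨α⟩ (λ ()))
    ⊨? (⟨ α ⟩ (φ ∨' ψ)) = no (λ ⊨⟨α⟩ → ⊨⟨α⟩ (λ ()))
    ⊨? (⟨ α ⟩ ⟨ β ⟩ φ)  = no (λ ⊨⟨α⟩ → ⊨⟨α⟩ (λ ()))
    ⊨? (⟨ α ⟩ □ φ)      = no (λ ⊨⟨α⟩ → ⊨⟨α⟩ (λ ()))
    ⊨? (□ φ)            = map′ (λ ⊨φ _ _ → ⊨φ) (λ ⊨□φ → ⊨□φ tt _) (⊨? φ)

    ⟦_⟧? : ∀ α → Dec (⟦ α ⟧ tt tt)
    ⟦ prg p ⟧?  = no (λ ())
    ⟦ α ⨟ β ⟧?  = map′ (tt ,_) proj₂ (⟦ α ⟧? ×-dec ⟦ β ⟧?)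
    ⟦ α ∪' β ⟧? = ⟦ α ⟧? ⊎-dec ⟦ β ⟧?
    ⟦ α * ⟧?    = yes ε
    ⟦ ¿ φ ⟧?    = map′ (refl ,_) proj₂ (⊨? φ)

  truth-bits : (xs : List Fm) → Vec Bool (length xs)
  truth-bits []       = []
  truth-bits (x ∷ xs) = does (⊨? x) ∷ truth-bits xs

  ⊨truth-literals : ∀ xs → tt ⊨ ⋀ (literals xs (truth-bits xs))
  ⊨truth-literals []       = λ ()
  ⊨truth-literals (x ∷ xs) with ⊨? x
  ... | yes ⊨x = ⊨∧-intro x      (⋀ (literals xs (truth-bits xs))) ⊨x (⊨truth-literals xs)
  ... | no ⊭x  = ⊨∧-intro (¬' x) (⋀ (literals xs (truth-bits xs))) ⊭x (⊨truth-literals xs)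

  some-MCS : (Γ : List Fm) → S Γ
  some-MCS Γ = _ , literals-MCS (truth-bits (closureₗ plain Γ))
                                (λ ⊢¬ → sound ⊢¬ tt (⊨truth-literals (closureₗ plain Γ)))

module _ {Γ : List Fm} where

  Rᶜ□-refl : Reflexive (Rᶜ□ Γ)
  Rᶜ□-refl {_ , mcs} = Consistent-mono (⇒-∧ ⇒-refl ◇-intro) (MCS.consistent mcs)

  Rᶜ□-sym : Symmetric (Rᶜ□ Γ)
  Rᶜ□-sym {_ , _} {_ , _} = ◇-symmetric

  vᶜp⊆Rᶜ□ : ∀ p {w v} → vᶜp Γ p w v → Rᶜ□ Γ w v
  vᶜp⊆Rᶜ□ p {_ , _} {_ , _} = Consistent-mono (∧-mapʳ ⟨⟩◇)

  open FiniteModel (closureₗ boxed Γ) (closureₗ-closed boxed Γ)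

  Refines : State → List Fm → Set
  Refines b W = Consistent ⌜ b ⌝ × (⊢ ⌜ b ⌝ ⇒ ⋀ W)

  refines : ∀ {W b} → MCS Γ W → Consistent (⋀ W ∧' ⌜ b ⌝) → Refines b W
  refines {W} {b} mcs k = Consistent-∧ʳ k , ⇒-⋀ (λ m → implied m (All.lookup (MCS.inFL± mcs) m))
    where
    implied : ∀ {x} → x ∈ W → FL± Γ x → ⊢ ⌜ b ⌝ ⇒ x
    implied m (inj₁ f) with decides (FL⇒∈closureₗ boxed f) b
    ... | inj₁ h = h
    ... | inj₂ h = ⊥-elim (k (refute-∧ (⋀-member m) h))
    implied m (inj₂ (ψ , f , refl)) with decides (FL⇒∈closureₗ boxed f) b
    ... | inj₁ h = ⊥-elim (k (refute-∧ (⋀-member m) (⇒-trans h ¬¬-intro)))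
    ... | inj₂ h = h

  refinements-agree : ∀ {W b c} → MCS Γ W → Refines b W → Refines c W → b ∼ c
  refinements-agree {W} mcs (kb , hb) (kc , hc) =
    inj₂ (kb , kc , λ m → transfer m kb hb hc , transfer m kc hc hb)
    where
    transfer : ∀ {φ b c} → □ φ ∈ closureₗ boxed Γ → Consistent ⌜ b ⌝ → ⊢ ⌜ b ⌝ ⇒ ⋀ W → ⊢ ⌜ c ⌝ ⇒ ⋀ W →
               ⊢ ⌜ b ⌝ ⇒ □ φ → ⊢ ⌜ c ⌝ ⇒ □ φ
    transfer m kb hb hc h =
      ⇒-trans hc (⋀-member (MCS-absorbs mcs (inj₁ (□∈closureₗ⇒FL Γ m)) (Consistent-mono (⇒-∧ h hb) kb)))

  ◇-refinements : ∀ {W₁ W₂} → MCS Γ W₁ → MCS Γ W₂ → Consistent (⋀ W₁ ∧' ◇ ⋀ W₂) →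
                  ¬ ¬ ∃₂ λ b₁ b₂ → Refines b₁ W₁ × Refines b₂ W₂ × b₁ ∼ b₂
  ◇-refinements mcs₁ mcs₂ k = do
    (b₂ , k₁ , k₂) ← diamond-witness ◇-normal k
    (b₁ , k₃) ← consistent-description k₁
    pure (b₁ , b₂ , refines mcs₁ (Consistent-mono (∧-map ∧-elimˡ ⇒-refl) k₃) , refines mcs₂ k₂
         , ◇⇒∼ (Consistent-mono (⇒-∧ ∧-elimʳ (⇒-trans ∧-elimˡ ∧-elimʳ)) k₃))

  Rᶜ□-trans : Transitive (Rᶜ□ Γ)
  Rᶜ□-trans {_ , mcs₁} {_ , mcs₂} {_ , mcs₃} k₁₂ k₂₃ = negated-stable do
    (b₁ , b₂ , (kb₁ , hb₁) , r₂ , b₁∼b₂) ← ◇-refinements mcs₁ mcs₂ k₁₂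
    (b₂′ , b₃ , r₂′ , (kb₃ , hb₃) , b₂′∼b₃) ← ◇-refinements mcs₂ mcs₃ k₂₃
    let b₁∼b₃ = ∼-trans b₁∼b₂ (∼-trans (refinements-agree mcs₂ r₂ r₂′) b₂′∼b₃)
    pure (Consistent-mono (∧-map hb₁ (◇-mono hb₃)) (∼⇒◇-consistent b₁∼b₃ kb₁ kb₃))
    where
    open IsEquivalence ∼-isEquivalence renaming (trans to ∼-trans)

lemma8 : (Γ : List Fm) → IsPDL□Model (S Γ) (vᶜf Γ) (vᶜp Γ) (Rᶜ□ Γ)
lemma8 Γ = record
  { nonempty = OnePoint.some-MCS Γ
  ; R-refl   = λ {w} → Rᶜ□-refl {Γ} {w}
  ; R-sym    = λ {w v} → Rᶜ□-sym {Γ} {w} {v}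
  ; R-trans  = λ {w v u} → Rᶜ□-trans {Γ} {w} {v} {u}
  ; vp⊆R□    = vᶜp⊆Rᶜ□
  }
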